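{- Let $\mathcal T$ be a complete tableau of order $t+1$ and height $u$, and let $C_j$ be its strongly extremal column. For $k\in\{1,\dots,t+1\}$ with $k\ne j$, the coefficient of $m^k$ in $f_{\mathcal T}$ equals $\operatorname{sgn}(k-j)\,c_i$ for some $i\in\{1,\dots,t\}$ if and only if $C_k$ is a quasi-extremal column of $\mathcal T$.
   Context: Let $T=\{1,\dots,t\}$, $\hat T=\{1,\dots,t+1\}$. A diagram of order $t+1$ is a tuple $(h_1,\dots,h_{t+1})$ of non-negative integers, pictured as columns $C_1,\dots,C_{t+1}$ of unit blocks; $B(i,j)$ is the block of $C_i$ at level $j\le h_i$, $R_j$ the set of blocks at level $j$, the height is $\max h_i$. Two distinct columns of height $\ge s$ are neighbours at level $s$ if all columns strictly between have height $<s$. A column is left (resp. right) extremal if it has no neighbour to its left (resp. right) at level equal to its height. Boundary conditions (always imposed): left extremal columns have even or maximal height; right extremal columns have odd or maximal height. Complete: no left even or right odd domino can be adjoined (a domino is two blocks added on a column of height $i$, even/odd as $i$ is, left (resp. right) if the enlarged column is the left (resp. right) neighbour at levels $i+1,i+2$ of some column of height $\ge i+2$). The strongly extremal column of a non-empty diagram of height $r$ is the leftmost column of height $r$ if $r$ is odd, the rightmost if $r$ is even; for the empty diagram it is $C_{t+1}$. For a complete tableau, a left (resp. right) quasi-extremal column is a column $C$, other than the strongly extremal column, such that every column to the left (resp. right) of $C$ has height at most that of $C$; a quasi-extremal column is one which is left or right quasi-extremal. Tableau: at each non-empty level $j$ the extremal block of $R_j$ is its rightmost block ($j$ odd) or leftmost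 ($j$ even), with no entry; $b(i,1)=i$ for non-extremal $B(i,1)$; for $j\ge1$ and non-extremal $B(i,j+1)$, $b(i,j+1)=b(k,j)$ with $C_k$ the left ($j$ odd) resp. right ($j$ even) neighbour of $C_i$ at level $j$. Functions: indeterminates $c_i$ ($i\in T$), $m^i$ ($i\in\hat T$); for $i<j$, $r^i-r^j:=m^i+2m^{i+1}+\dots+2m^{j-1}+m^j$, $r^j-r^i:=-(r^i-r^j)$; $h=-\sum_{i\in T}c_im^i$; for level $s$ with columns of height $\ge s$ indexed $u_1<\dots<u_k$: $f_{R_s}=\sum_{i=1}^{k-1}c_{b(u_i,s)}(r^{u_i}-r^{u_{i+1}})$ ($s$ odd), $\sum_{i=2}^kc_{b(u_i,s)}(r^{u_i}-r^{u_{i-1}})$ ($s$ even); $f_{\mathcal T}=h+\sum_{s\ge1}f_{R_s}$. $\operatorname{sgn}$ denotes the sign ($\pm1$). -}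

module Defs where

open import Data.Nat as ℕ using (ℕ; zero; suc; _≤_; _<_; _⊔_)
open import Data.Bool using (Bool; true; false; not; if_then_else_)
open import Data.Fin as Fin using (Fin; toℕ; inject₁; fromℕ)
open import Data.Fin.Properties using (_≟_)
open import Data.Integer as ℤ using (ℤ; +_; -_)
open import Data.List as List using (List; []; _∷_; filter; map; foldr; upTo; allFin)
open import Data.Product using (Σ; ∃; _×_; _,_)
open import Data.Sum using (_⊎_)
open import Relation.Nullary using (¬_; Dec; yes; no)
open import Relation.Nullary.Decidable using (⌊_⌋)
open import Relation.Binary.PropositionalEquality using (_≡_; _≢_)

-- Diagrams of order t+1.  Column C_i (paper index i ∈ {1,…,t+1}) is the
-- element i-1 of Fin (suc t); d c is the height h_i of that column.

Diagram : ℕ → Set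
Diagram t = Fin (suc t) → ℕ

isEven : ℕ → Bool
isEven zero = true
isEven (suc n) = not (isEven n)

Even Odd : ℕ → Set
Even n = isEven n ≡ true
Odd n = isEven n ≡ false

maxF : ∀ {n} → (Fin n → ℕ) → ℕ
maxF {zero} f = 0
maxF {suc n} f = f Fin.zero ⊔ maxF (λ i → f (Fin.suc i))

height : ∀ {t} → Diagram t → ℕ
height d = maxF d

Neighbours : ∀ {t} → Diagram t → ℕ → Fin (suc t) → Fin (suc t) → Set
Neighbours d s a b =
  a ≢ b × s ≤ d a × s ≤ d b ×
  (∀ c → ((a Fin.< c × c Fin.< b) ⊎ (b Fin.< c × c Fin.< a)) → d c < s)

LeftNb : ∀ {t} → Diagram t → ℕ → Fin (suc t) → Fin (suc t) → Set
LeftNb d s a b = a Fin.< b × Neighbours d s a b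

RightNb : ∀ {t} → Diagram t → ℕ → Fin (suc t) → Fin (suc t) → Set
RightNb d s a b = b Fin.< a × Neighbours d s a b

LeftExtremal RightExtremal : ∀ {t} → Diagram t → Fin (suc t) → Set
LeftExtremal d a = ¬ (∃ λ b → LeftNb d (d a) b a)
RightExtremal d a = ¬ (∃ λ b → RightNb d (d a) b a)

Boundary : ∀ {t} → Diagram t → Set
Boundary d = ∀ a →
  (LeftExtremal d a → Even (d a) ⊎ d a ≡ height d) ×
  (RightExtremal d a → Odd (d a) ⊎ d a ≡ height d)

-- the diagram obtained by putting two blocks (a domino) on column a
adjoin : ∀ {t} → Diagram t → Fin (suc t) → Diagram t
adjoin d a c = if ⌊ c ≟ a ⌋ then suc (suc (d a)) else d c

LeftDomino RightDomino : ∀ {t} → Diagram t → Fin (suc t) → Set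
LeftDomino d a = ∃ λ b → suc (suc (d a)) ≤ d b ×
  LeftNb (adjoin d a) (suc (d a)) a b × LeftNb (adjoin d a) (suc (suc (d a))) a b
RightDomino d a = ∃ λ b → suc (suc (d a)) ≤ d b ×
  RightNb (adjoin d a) (suc (d a)) a b × RightNb (adjoin d a) (suc (suc (d a))) a b

Complete : ∀ {t} → Diagram t → Set
Complete d = ¬ (∃ λ a → Even (d a) × LeftDomino d a)
           × ¬ (∃ λ a → Odd (d a) × RightDomino d a)

StronglyExtremal : ∀ {t} → Diagram t → Fin (suc t) → Set
StronglyExtremal {t} d j =
  (height d ≡ 0 × j ≡ fromℕ t)
  ⊎ (height d ≢ 0 × Odd (height d) × d j ≡ height d × (∀ c → c Fin.< j → d c ≢ height d))
  ⊎ (height d ≢ 0 × Even (height d) × d j ≡ height d × (∀ c → j Fin.< c → d c ≢ height d))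

LeftQuasiExtremal RightQuasiExtremal QuasiExtremal :
  ∀ {t} → Diagram t → (j k : Fin (suc t)) → Set
LeftQuasiExtremal d j k = k ≢ j × (∀ c → c Fin.< k → d c ≤ d k)
RightQuasiExtremal d j k = k ≢ j × (∀ c → k Fin.< c → d c ≤ d k)
QuasiExtremal d j k = LeftQuasiExtremal d j k ⊎ RightQuasiExtremal d j k

-- Tableaux.  The entry of block B(i,s) is  b i s ∈ T = Fin t
-- (c-index i ∈ Fin t stands for the paper index i+1).
-- Entries of extremal / non-existent blocks are irrelevant.

-- B(i,s) exists (1 ≤ s ≤ h_i) and is not the extremal block of R_s
NonExtremal : ∀ {t} → Diagram t → Fin (suc t) → ℕ → Set
NonExtremal d i s = 1 ≤ s × s ≤ d i ×
  (Odd s → ∃ λ c → i Fin.< c × s ≤ d c) ×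
  (Even s → ∃ λ c → c Fin.< i × s ≤ d c)

IsTableau : ∀ {t} → Diagram t → (Fin (suc t) → ℕ → Fin t) → Set
IsTableau d b =
  (∀ i → NonExtremal d i 1 → toℕ (b i 1) ≡ toℕ i) ×
  (∀ i s k → 1 ≤ s → NonExtremal d i (suc s) →
     (Odd s → LeftNb d s k i → b i (suc s) ≡ b k s) ×
     (Even s → RightNb d s k i → b i (suc s) ≡ b k s))

-- An element of  ℤ[c_i] ⊗ ℤ[m^k]  bilinear in c, m is
-- represented by its coefficient matrix:  F k i = coefficient of c_i m^k
-- (k ∈ Fin (suc t) ↔ paper index k+1, i ∈ Fin t ↔ paper index i+1).

Form : ℕ → Set
Form t = Fin (suc t) → Fin t → ℤ

zeroF : ∀ {t} → Form t
zeroF k i = + 0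

_⊕_ : ∀ {t} → Form t → Form t → Form t
(F ⊕ G) k i = F k i ℤ.+ G k i

sumF : ∀ {t} → List (Form t) → Form t
sumF = foldr _⊕_ zeroF

δ : ∀ {n} → Fin n → Fin n → ℤ
δ x y = if ⌊ x ≟ y ⌋ then + 1 else + 0

-- coefficients (in the m^k) of  r^a - r^b  for a < b:  m^a + 2m^{a+1} + … + 2m^{b-1} + m^b
rPos : ∀ {t} → Fin (suc t) → Fin (suc t) → Fin (suc t) → ℤ
rPos a b k =
  if ⌊ k ≟ a ⌋ then + 1 else
  if ⌊ k ≟ b ⌋ then + 1 else
  if ⌊ a Fin.<? k ⌋ Data.Bool.∧ ⌊ k Fin.<? b ⌋ then + 2 else + 0
  where import Data.Bool

rDiff : ∀ {t} → Fin (suc t) → Fin (suc t) → Fin (suc t) → ℤ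
rDiff a b k = if ⌊ a Fin.<? b ⌋ then rPos a b k else - rPos b a k

cr : ∀ {t} → Fin t → Fin (suc t) → Fin (suc t) → Form t
cr x a b k i = δ i x ℤ.* rDiff a b k

hF : ∀ {t} → Form t
hF k i = - δ (inject₁ i) k

columnsAt : ∀ {t} → Diagram t → ℕ → List (Fin (suc t))
columnsAt d s = filter (λ c → s ℕ.≤? d c) (allFin _)

consecutive : ∀ {A : Set} → List A → List (A × A)
consecutive [] = []
consecutive (x ∷ []) = []
consecutive (x ∷ y ∷ xs) = (x , y) ∷ consecutive (y ∷ xs)

fR : ∀ {t} → Diagram t → (Fin (suc t) → ℕ → Fin t) → ℕ → Form t
fR d b s =
  if isEven s
  then sumF (map (λ { (u , v) → cr (b v s) v u }) (consecutive (columnsAt d s)))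
  else sumF (map (λ { (u , v) → cr (b u s) u v }) (consecutive (columnsAt d s)))

-- f_T = h + Σ_{s ≥ 1} f_{R_s}   (levels above the height contribute 0)
fT : ∀ {t} → Diagram t → (Fin (suc t) → ℕ → Fin t) → Form t
fT d b = hF ⊕ sumF (map (λ s → fR d b (suc s)) (upTo (height d)))

sgnDiff : ∀ {n} → Fin n → Fin n → ℤ
sgnDiff k j = if ⌊ j Fin.<? k ⌋ then + 1 else - (+ 1)

-- The coefficient of m^k is computed level by level (sumPairs-coeff): at a level
-- reached by C_k it consists of the terms of the pairs (left neighbour, k) and
-- (k, right neighbour); at a level above C_k it is twice the term of the pair spanning k.
--   * Below the top of C_k, the tableau rules and the boundary conditions make the
--     neighbour term of each level cancel the own term of the next one, and h cancels
--     the own term of level 1 (telescope, h-cancels-own); only the neighbour term of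
--     the top level survives.
--   * If C_k is at least as high as every column on one side, no higher level
--     contributes and the position of C_k relative to C_j gives the sign
--     (oneSided⇒signedEntry).
--   * Otherwise level h_k + 1 contributes ±2 c_β for an entry β which, by the bounds on
--     positions of entries (entryBounds) and the staircase forced by completeness
--     (staircase), occurs at no other level (BetweenHigherColumns.not-signed).
module Submission where

open import Defs
open import Data.Nat using (ℕ; suc)
open import Data.Fin using (Fin)
open import Data.Integer using (ℤ; _*_)
open import Data.Product using (Σ; _×_)
open import Function.Bundles using (_⇔_)
open import Relation.Binary.PropositionalEquality using (_≡_; _≢_)

open import Data.Nat as ℕ using (zero; z≤n; s≤s; z<s; s<s)
import Data.Nat.Properties as ℕP
open import Data.Bool using (Bool; true; false; not; if_then_else_; _∧_)
open import Data.Fin as Fin using (toℕ)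
open import Data.Fin.Properties using (_≟_; toℕ-injective; <-cmp)
import Data.Fin.Properties as FinP
open import Data.Integer using (+_; -_; _+_; ∣_∣)
import Data.Integer.Properties as ℤP
open import Data.List as List using (List; []; _∷_; filter; map; allFin)
import Data.List.Properties as LP
open import Data.List.Relation.Unary.AllPairs using (AllPairs; _∷_)
import Data.List.Relation.Unary.AllPairs.Properties as AllPairsP
open import Data.List.Relation.Unary.All as All using (_∷_)
open import Data.List.Membership.Propositional using (_∈_)
import Data.List.Membership.Propositional.Properties as ∈P
open import Data.List.Relation.Unary.Any using (here; there)
open import Data.Product using (_,_; proj₁; proj₂)
open import Data.Sum using (_⊎_; inj₁; inj₂; [_,_]′)
open import Data.Empty using (⊥; ⊥-elim)
open import Data.Unit using (⊤)
open import Relation.Nullary using (¬_; Dec; yes; no; does)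
open import Relation.Nullary.Decidable using (⌊_⌋; _×-dec_; dec-true; dec-false)
open import Relation.Unary using (Pred; Decidable)
open import Relation.Binary.Definitions using (Tri; tri<; tri≈; tri>)
open import Relation.Binary.PropositionalEquality using (refl; sym; trans; cong; cong₂; subst; module ≡-Reasoning)
open import Function using (_∘_)
open import Function.Bundles using (mk⇔)
open import Level using (0ℓ)

-- It is computed on the underlying naturals so that
-- shifting all three columns by one leaves it unchanged definitionally.
rCoeffℕ : ℕ → ℕ → ℕ → ℤ
rCoeffℕ a b c =
  if does (c ℕ.≟ a) then + 1 else
  if does (c ℕ.≟ b) then + 1 else
  if does (a ℕ.<? c) ∧ does (c ℕ.<? b) then + 2 else + 0

rCoeff : ∀ {n} → Fin n → Fin n → Fin n → ℤ
rCoeff u v k = rCoeffℕ (toℕ u) (toℕ v) (toℕ k)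

rCoeff-right-end : ∀ b → rCoeffℕ 0 (suc b) (suc b) ≡ + 1
rCoeff-right-end b rewrite dec-true (b ℕ.≟ b) refl = refl

rCoeff-inside : ∀ {b c} → c ℕ.< b → rCoeffℕ 0 (suc b) (suc c) ≡ + 2
rCoeff-inside {b} {c} c<b
  rewrite dec-false (c ℕ.≟ b) (ℕP.<⇒≢ c<b) | dec-true (c ℕ.<? b) c<b = refl

rCoeff-outside : ∀ {b c} → b ℕ.< c → rCoeffℕ 0 (suc b) (suc c) ≡ + 0
rCoeff-outside {b} {c} b<c
  rewrite dec-false (c ℕ.≟ b) (ℕP.<⇒≢ b<c ∘ sym) | dec-false (c ℕ.<? b) (ℕP.<-asym b<c) = refl

≟-toℕ : ∀ {n} (x y : Fin n) → ⌊ x ≟ y ⌋ ≡ does (toℕ x ℕ.≟ toℕ y)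
≟-toℕ x y with x ≟ y
... | yes x≡y = sym (dec-true (toℕ x ℕ.≟ toℕ y) (cong toℕ x≡y))
... | no x≢y = sym (dec-false (toℕ x ℕ.≟ toℕ y) (x≢y ∘ toℕ-injective))

<?-toℕ : ∀ {n} (x y : Fin n) → ⌊ x Fin.<? y ⌋ ≡ does (toℕ x ℕ.<? toℕ y)
<?-toℕ x y with x Fin.<? y
... | yes x<y = sym (dec-true (toℕ x ℕ.<? toℕ y) x<y)
... | no x≮y = sym (dec-false (toℕ x ℕ.<? toℕ y) x≮y)

rPos≡rCoeff : ∀ {t} (a b k : Fin (suc t)) → rPos a b k ≡ rCoeff a b k
rPos≡rCoeff a b k
  rewrite ≟-toℕ k a | ≟-toℕ k b | <?-toℕ a k | <?-toℕ k b = refl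

Least Greatest : ∀ {n} → (Fin n → Set) → Set
Least {n} P = Σ (Fin n) λ v → P v × (∀ c → c Fin.< v → ¬ P c)
Greatest {n} P = Σ (Fin n) λ v → P v × (∀ c → v Fin.< c → ¬ P c)

findLeast : ∀ {n} {P : Fin n → Set} → Decidable P → Least P ⊎ (∀ c → ¬ P c)
findLeast {zero} P? = inj₂ (λ ())
findLeast {suc n} {P} P? with P? Fin.zero | findLeast (P? ∘ Fin.suc)
... | yes P0 | _ = inj₁ (Fin.zero , P0 , λ _ ())
... | no ¬P0 | inj₁ (v , Pv , least) = inj₁ (Fin.suc v , Pv , below)
  where
  below : ∀ c → c Fin.< Fin.suc v → ¬ P c
  below Fin.zero _ = ¬P0
  below (Fin.suc c) (s≤s c<v) = least c c<v
... | no ¬P0 | inj₂ none = inj₂ λ { Fin.zero → ¬P0 ; (Fin.suc c) → none c }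

findGreatest : ∀ {n} {P : Fin n → Set} → Decidable P → Greatest P ⊎ (∀ c → ¬ P c)
findGreatest {zero} P? = inj₂ (λ ())
findGreatest {suc n} {P} P? with findGreatest (P? ∘ Fin.suc) | P? Fin.zero
... | inj₁ (v , Pv , greatest) | _ = inj₁ (Fin.suc v , Pv , above)
  where
  above : ∀ c → Fin.suc v Fin.< c → ¬ P c
  above (Fin.suc c) (s≤s v<c) = greatest c v<c
... | inj₂ none | yes P0 = inj₁ (Fin.zero , P0 , λ { (Fin.suc c) _ → none c })
... | inj₂ none | no ¬P0 = inj₂ λ { Fin.zero → ¬P0 ; (Fin.suc c) → none c }

-- The nearest column strictly left (resp. right) of k satisfying P, or evidence
-- that there is none.  At level s with P = "height ≥ s" these are the neighbours.
data NearestLeft {n} (P : Fin n → Set) (k : Fin n) : Set where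
  leftAt : (u : Fin n) → u Fin.< k → P u → (∀ c → u Fin.< c → c Fin.< k → ¬ P c) →
    NearestLeft P k
  noLeft : (∀ c → c Fin.< k → ¬ P c) → NearestLeft P k

data NearestRight {n} (P : Fin n → Set) (k : Fin n) : Set where
  rightAt : (v : Fin n) → k Fin.< v → P v → (∀ c → k Fin.< c → c Fin.< v → ¬ P c) →
    NearestRight P k
  noRight : (∀ c → k Fin.< c → ¬ P c) → NearestRight P k

nearestLeft : ∀ {n} {P : Fin n → Set} → Decidable P → (k : Fin n) → NearestLeft P k
nearestLeft P? k with findGreatest (λ c → (c Fin.<? k) ×-dec P? c)
... | inj₁ (u , (u<k , Pu) , greatest) =
  leftAt u u<k Pu (λ c u<c c<k Pc → greatest c u<c (c<k , Pc))
... | inj₂ none = noLeft (λ c c<k Pc → none c (c<k , Pc))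

nearestRight : ∀ {n} {P : Fin n → Set} → Decidable P → (k : Fin n) → NearestRight P k
nearestRight P? k with findLeast (λ c → (k Fin.<? c) ×-dec P? c)
... | inj₁ (v , (k<v , Pv) , least) =
  rightAt v k<v Pv (λ c k<c c<v Pc → least c c<v (k<c , Pc))
... | inj₂ none = noRight (λ c k<c Pc → none c (k<c , Pc))

module _ {n} {P : Fin n → Set} {k : Fin n} where
  atLeft : NearestLeft P k → (Fin n → ℤ) → ℤ
  atLeft (leftAt u _ _ _) f = f u
  atLeft (noLeft _) f = + 0

  atRight : NearestRight P k → (Fin n → ℤ) → ℤ
  atRight (rightAt v _ _ _) f = f v
  atRight (noRight _) f = + 0

  across : NearestLeft P k → NearestRight P k → (Fin n → Fin n → ℤ) → ℤ
  across (leftAt u _ _ _) (rightAt v _ _ _) f = f u v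
  across (leftAt _ _ _ _) (noRight _) f = + 0
  across (noLeft _) _ f = + 0

  -- The m^k-coefficient of  Σ w u v (r^u − r^v)  over consecutive columns u < v of P:
  -- if k ∈ P it meets the pairs (left, k) and (k, right) with coefficient 1 each,
  -- otherwise it lies inside at most one pair, with coefficient 2.
  pairCoeff : Dec (P k) → NearestLeft P k → NearestRight P k → (Fin n → Fin n → ℤ) → ℤ
  pairCoeff (yes _) L R w = atLeft L (λ u → w u k) + atRight R (λ v → w k v)
  pairCoeff (no _) L R w = across L R (λ u v → + 2 * w u v)

  pairCoeff-reached : {w : Fin n → Fin n → ℤ} (Pk? : Dec (P k)) → P k → (L : NearestLeft P k) (R : NearestRight P k) →
    pairCoeff Pk? L R w ≡ atLeft L (λ u → w u k) + atRight R (λ v → w k v)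
  pairCoeff-reached (yes _) _ L R = refl
  pairCoeff-reached (no ¬Pk) Pk L R = ⊥-elim (¬Pk Pk)

  pairCoeff-unreached : {w : Fin n → Fin n → ℤ} (Pk? : Dec (P k)) → ¬ P k → (L : NearestLeft P k) (R : NearestRight P k) →
    pairCoeff Pk? L R w ≡ across L R (λ u v → + 2 * w u v)
  pairCoeff-unreached (no _) _ L R = refl
  pairCoeff-unreached (yes Pk) ¬Pk L R = ⊥-elim (¬Pk Pk)

sumℤ : List ℤ → ℤ
sumℤ = List.foldr _+_ (+ 0)

sumPairs : ∀ {A : Set} → (A × A → ℤ) → List A → ℤ
sumPairs f xs = sumℤ (map f (consecutive xs))

headPair : ∀ {A : Set} → (A → ℤ) → List A → ℤ
headPair g [] = + 0
headPair g (y ∷ _) = g y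

consecutive-map : ∀ {A B : Set} (g : A → B) (xs : List A) →
  consecutive (map g xs) ≡ map (Data.Product.map g g) (consecutive xs)
consecutive-map g [] = refl
consecutive-map g (x ∷ []) = refl
consecutive-map g (x ∷ y ∷ xs) = cong ((g x , g y) ∷_) (consecutive-map g (y ∷ xs))

sumPairs-map : ∀ {A B : Set} (f : B × B → ℤ) (g : A → B) (xs : List A) →
  sumPairs f (map g xs) ≡ sumPairs (f ∘ Data.Product.map g g) xs
sumPairs-map f g xs =
  cong sumℤ (trans (cong (map f) (consecutive-map g xs)) (sym (LP.map-∘ (consecutive xs))))

sumPairs-cons-map : ∀ {A B : Set} (f : B × B → ℤ) (g : A → B) (x : B) (ys : List A) →
  sumPairs f (x ∷ map g ys) ≡
  headPair (λ y → f (x , g y)) ys + sumPairs (f ∘ Data.Product.map g g) ys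
sumPairs-cons-map f g x [] = refl
sumPairs-cons-map f g x (y ∷ ys) = cong (λ z → f (x , g y) + z) (sumPairs-map f g (y ∷ ys))

sumPairs-vanishing : ∀ {n} (f : Fin n × Fin n → ℤ) →
  (∀ {u v} → u Fin.< v → f (u , v) ≡ + 0) →
  ∀ xs → AllPairs Fin._<_ xs → sumPairs f xs ≡ + 0
sumPairs-vanishing f vanish [] _ = refl
sumPairs-vanishing f vanish (x ∷ []) _ = refl
sumPairs-vanishing f vanish (x ∷ y ∷ xs) ((x<y ∷ _) ∷ sorted) =
  cong₂ _+_ (vanish x<y) (sumPairs-vanishing f vanish (y ∷ xs) sorted)

select : ∀ {n} {P : Fin n → Set} → Decidable P → List (Fin n)
select {n} P? = filter P? (allFin n)

select-sorted : ∀ {n} {P : Fin n → Set} (P? : Decidable P) → AllPairs Fin._<_ (select P?)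
select-sorted P? = AllPairsP.filter⁺ P? (AllPairsP.tabulate⁺-< (λ i<j → i<j))

select-∈ : ∀ {n} {P : Fin n → Set} (P? : Decidable P) {c} → P c → c ∈ select P?
select-∈ {n} P? Pc = ∈P.∈-filter⁺ P? {xs = allFin n} (∈P.∈-allFin _) Pc

filter-map : ∀ {A B : Set} {P : Pred B 0ℓ} (P? : Decidable P) (g : A → B) (xs : List A) →
  filter P? (map g xs) ≡ map g (filter (P? ∘ g) xs)
filter-map P? g [] = refl
filter-map P? g (x ∷ xs) with P? (g x)
... | yes _ = cong (g x ∷_) (filter-map P? g xs)
... | no _ = filter-map P? g xs

select-suc : ∀ {n} {P : Fin (suc n) → Set} (P? : Decidable P) →
  select P? ≡ filter P? (Fin.zero ∷ map Fin.suc (allFin n))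
select-suc {n} P? = cong (λ xs → filter P? (Fin.zero ∷ xs)) (sym (LP.map-tabulate (λ x → x) Fin.suc))

select-head : ∀ {n} {P : Fin n → Set} (P? : Decidable P) {y ys} → select P? ≡ y ∷ ys →
  P y × (∀ c → c Fin.< y → ¬ P c)
select-head {n} {P} P? {y} {ys} eq = Py , below
  where
  Py : P y
  Py = proj₂ (∈P.∈-filter⁻ P? {xs = allFin n} (subst (y ∈_) (sym eq) (here refl)))
  below : ∀ c → c Fin.< y → ¬ P c
  below c c<y Pc with subst (c ∈_) eq (select-∈ P? Pc) | subst (AllPairs Fin._<_) eq (select-sorted P?)
  ... | here refl | _ = ℕP.<-irrefl refl c<y
  ... | there c∈ys | y<ys ∷ _ = ℕP.<-asym c<y (All.lookup y<ys c∈ys)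

select-empty : ∀ {n} {P : Fin n → Set} (P? : Decidable P) → select P? ≡ [] → ∀ c → ¬ P c
select-empty P? eq c Pc with subst (c ∈_) eq (select-∈ P? Pc)
... | ()

module _ {n} {P : Fin (suc n) → Set} {k : Fin n} where
  shiftLeft : NearestLeft P (Fin.suc k) → NearestLeft (P ∘ Fin.suc) k
  shiftLeft (leftAt (Fin.suc u) (s≤s u<k) Pu gap) =
    leftAt u u<k Pu (λ c u<c c<k → gap (Fin.suc c) (s<s u<c) (s<s c<k))
  shiftLeft (leftAt Fin.zero _ _ gap) = noLeft (λ c c<k → gap (Fin.suc c) z<s (s<s c<k))
  shiftLeft (noLeft none) = noLeft (λ c c<k → none (Fin.suc c) (s<s c<k))

  shiftRight : NearestRight P (Fin.suc k) → NearestRight (P ∘ Fin.suc) k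
  shiftRight (rightAt (Fin.suc v) (s≤s k<v) Pv gap) =
    rightAt v k<v Pv (λ c k<c c<v → gap (Fin.suc c) (s<s k<c) (s<s c<v))
  shiftRight (noRight none) = noRight (λ c k<c → none (Fin.suc c) (s<s k<c))

  -- The left neighbour is not column 0 (so shifting does not lose it).
  NotAtZero : NearestLeft P (Fin.suc k) → Set
  NotAtZero (leftAt Fin.zero _ _ _) = ⊥
  NotAtZero _ = ⊤

  pairCoeff-shift : (w : Fin (suc n) → Fin (suc n) → ℤ) (Pk? : Dec (P (Fin.suc k)))
    (L : NearestLeft P (Fin.suc k)) (R : NearestRight P (Fin.suc k)) → NotAtZero L →
    pairCoeff Pk? L R w ≡
    pairCoeff Pk? (shiftLeft L) (shiftRight R) (λ u v → w (Fin.suc u) (Fin.suc v))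
  pairCoeff-shift w (yes _) (leftAt (Fin.suc _) (s≤s _) _ _) (rightAt (Fin.suc _) (s≤s _) _ _) _ = refl
  pairCoeff-shift w (yes _) (leftAt (Fin.suc _) (s≤s _) _ _) (noRight _) _ = refl
  pairCoeff-shift w (yes _) (noLeft _) (rightAt (Fin.suc _) (s≤s _) _ _) _ = refl
  pairCoeff-shift w (yes _) (noLeft _) (noRight _) _ = refl
  pairCoeff-shift w (no _) (leftAt (Fin.suc _) (s≤s _) _ _) (rightAt (Fin.suc _) (s≤s _) _ _) _ = refl
  pairCoeff-shift w (no _) (leftAt (Fin.suc _) (s≤s _) _ _) (noRight _) _ = refl
  pairCoeff-shift w (no _) (noLeft _) (rightAt (Fin.suc _) (s≤s _) _ _) _ = refl
  pairCoeff-shift w (no _) (noLeft _) (noRight _) _ = refl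

  atRight-shift : (R : NearestRight P (Fin.suc k)) (f : Fin (suc n) → ℤ) →
    atRight (shiftRight R) (f ∘ Fin.suc) ≡ atRight R f
  atRight-shift (rightAt (Fin.suc v) (s≤s _) _ _) f = refl
  atRight-shift (noRight _) f = refl

least-from-gap : ∀ {n} {P : Fin n → Set} {y v : Fin n} →
  (∀ c → c Fin.< y → ¬ P c) → P y → P v → (∀ c → y Fin.≤ c → c Fin.< v → ¬ P c) → v ≡ y
least-from-gap {y = y} {v = v} least Py Pv gap with <-cmp v y
... | tri< v<y _ _ = ⊥-elim (least v v<y Pv)
... | tri≈ _ v≡y _ = v≡y
... | tri> _ _ y<v = ⊥-elim (gap y ℕP.≤-refl y<v Py)

-- Induction on the number of columns: column 0 can only
-- occur in the first pair, and the remaining pairs are the same problem shifted by one.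
sumPairs-coeff : ∀ n {P : Fin n → Set} (P? : Decidable P) (k : Fin n)
  (L : NearestLeft P k) (R : NearestRight P k) (w : Fin n → Fin n → ℤ) (f : Fin n × Fin n → ℤ) →
  (∀ u v → u Fin.< v → f (u , v) ≡ w u v * rCoeff u v k) →
  sumPairs f (select P?) ≡ pairCoeff (P? k) L R w
sumPairs-coeff (suc n) {P} P? k L R w f f≡ =
  trans (cong (sumPairs f) (select-suc P?)) (byColumn0 k L R f≡)
  where
  open ≡-Reasoning
  zs : List (Fin n)
  zs = select (P? ∘ Fin.suc)
  fs : Fin n × Fin n → ℤ
  fs = f ∘ Data.Product.map Fin.suc Fin.suc
  ws : Fin n → Fin n → ℤ
  ws u v = w (Fin.suc u) (Fin.suc v)
  firstPair : List (Fin n) → ℤ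
  firstPair = headPair (λ y → f (Fin.zero , Fin.suc y))

  dropping0 : sumPairs f (filter P? (map Fin.suc (allFin n))) ≡ sumPairs fs zs
  dropping0 = trans (cong (sumPairs f) (filter-map P? Fin.suc (allFin n))) (sumPairs-map f Fin.suc zs)

  keeping0 : sumPairs f (Fin.zero ∷ filter P? (map Fin.suc (allFin n))) ≡ firstPair zs + sumPairs fs zs
  keeping0 = trans (cong (λ xs → sumPairs f (Fin.zero ∷ xs)) (filter-map P? Fin.suc (allFin n)))
                   (sumPairs-cons-map f Fin.suc Fin.zero zs)

  -- k = 0: the shifted pairs lie strictly right of column 0.
  shifted-at-0 : (∀ u v → u Fin.< v → f (u , v) ≡ w u v * rCoeff u v Fin.zero) → sumPairs fs zs ≡ + 0
  shifted-at-0 f≡ = sumPairs-vanishing fs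
    (λ {u} {v} u<v → trans (f≡ _ _ (s<s u<v)) (ℤP.*-zeroʳ (w (Fin.suc u) (Fin.suc v)))) zs (select-sorted _)

  firstPair-at-0 : (∀ u v → u Fin.< v → f (u , v) ≡ w u v * rCoeff u v Fin.zero) →
    ∀ {ys} → zs ≡ ys → (R : NearestRight P Fin.zero) → firstPair ys ≡ atRight R (w Fin.zero)
  firstPair-at-0 f≡ {[]} eq (noRight _) = refl
  firstPair-at-0 f≡ {[]} eq (rightAt (Fin.suc v) _ Pv _) = ⊥-elim (select-empty _ eq v Pv)
  firstPair-at-0 f≡ {y ∷ _} eq (noRight none) = ⊥-elim (none (Fin.suc y) z<s (proj₁ (select-head _ eq)))
  firstPair-at-0 f≡ {y ∷ _} eq (rightAt (Fin.suc v) _ Pv gap)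
    with refl ← least-from-gap (proj₂ (select-head _ eq)) (proj₁ (select-head _ eq)) Pv
                  (λ c _ c<v → gap (Fin.suc c) z<s (s<s c<v)) =
    trans (f≡ Fin.zero (Fin.suc v) z<s) (ℤP.*-identityʳ (w Fin.zero (Fin.suc v)))

  module _ (k′ : Fin n) (f≡ : ∀ u v → u Fin.< v → f (u , v) ≡ w u v * rCoeff u v (Fin.suc k′)) where
    firstPair-beyond : ∀ {y} → y Fin.< k′ → f (Fin.zero , Fin.suc y) ≡ + 0
    firstPair-beyond {y} y<k′ = trans (f≡ Fin.zero (Fin.suc y) z<s)
      (trans (cong (w Fin.zero (Fin.suc y) *_) (rCoeff-outside y<k′)) (ℤP.*-zeroʳ (w Fin.zero (Fin.suc y))))

    firstPair-ends : ∀ {y} → y ≡ k′ → f (Fin.zero , Fin.suc y) ≡ w Fin.zero (Fin.suc k′)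
    firstPair-ends refl = trans (f≡ Fin.zero (Fin.suc k′) z<s)
      (trans (cong (w Fin.zero (Fin.suc k′) *_) (rCoeff-right-end (toℕ k′))) (ℤP.*-identityʳ _))

    firstPair-spans : ∀ {y} → k′ Fin.< y → f (Fin.zero , Fin.suc y) ≡ + 2 * w Fin.zero (Fin.suc y)
    firstPair-spans {y} k′<y = trans (f≡ Fin.zero (Fin.suc y) z<s)
      (trans (cong (w Fin.zero (Fin.suc y) *_) (rCoeff-inside k′<y)) (ℤP.*-comm (w Fin.zero (Fin.suc y)) (+ 2)))

    withColumn0 : P Fin.zero → (L : NearestLeft P (Fin.suc k′)) (R : NearestRight P (Fin.suc k′)) →
      ∀ {ys} → zs ≡ ys →
      firstPair ys + pairCoeff (P? (Fin.suc k′)) (shiftLeft L) (shiftRight R) ws ≡ pairCoeff (P? (Fin.suc k′)) L R w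
    withColumn0 P0 (noLeft none) R eq = ⊥-elim (none Fin.zero z<s P0)
    withColumn0 P0 L@(leftAt (Fin.suc u) (s≤s u<k′) Pu _) R {ys} eq = begin
        firstPair ys + pairCoeff (P? (Fin.suc k′)) (shiftLeft L) (shiftRight R) ws
      ≡⟨ cong (_+ pairCoeff (P? (Fin.suc k′)) (shiftLeft L) (shiftRight R) ws) (head0 ys eq) ⟩
        + 0 + pairCoeff (P? (Fin.suc k′)) (shiftLeft L) (shiftRight R) ws
      ≡⟨ ℤP.+-identityˡ _ ⟩
        pairCoeff (P? (Fin.suc k′)) (shiftLeft L) (shiftRight R) ws
      ≡⟨ sym (pairCoeff-shift w (P? (Fin.suc k′)) L R _) ⟩
        pairCoeff (P? (Fin.suc k′)) L R w ∎
      where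
      head0 : ∀ ys → zs ≡ ys → firstPair ys ≡ + 0
      head0 [] _ = refl
      head0 (y ∷ _) eq = firstPair-beyond
        (ℕP.≤-<-trans (ℕP.≮⇒≥ (λ u<y → proj₂ (select-head _ eq) u u<y Pu)) u<k′)
    withColumn0 P0 (leftAt Fin.zero z<s _ gap) R {[]} eq with P? (Fin.suc k′) | R
    ... | yes Pk | _ = ⊥-elim (select-empty _ eq k′ Pk)
    ... | no _ | noRight _ = refl
    ... | no _ | rightAt (Fin.suc v) _ Pv _ = ⊥-elim (select-empty _ eq v Pv)
    withColumn0 P0 (leftAt Fin.zero z<s _ gap) R {y ∷ _} eq with select-head _ eq | <-cmp y k′
    ... | Py , _ | tri< y<k′ _ _ = ⊥-elim (gap (Fin.suc y) z<s (s<s y<k′) Py)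
    ... | Py , _ | tri≈ _ refl _ with P? (Fin.suc y)
    ...   | no ¬Pk = ⊥-elim (¬Pk Py)
    ...   | yes _ = cong₂ _+_ (firstPair-ends refl) (trans (ℤP.+-identityˡ _) (atRight-shift R (w (Fin.suc y))))
    withColumn0 P0 (leftAt Fin.zero z<s _ gap) R {y ∷ _} eq | Py , least | tri> _ _ k′<y
      with P? (Fin.suc k′) | R
    ... | yes Pk | _ = ⊥-elim (least k′ k′<y Pk)
    ... | no _ | noRight none = ⊥-elim (none (Fin.suc y) (s<s k′<y) Py)
    ... | no _ | rightAt (Fin.suc v) _ Pv gapR
      with refl ← least-from-gap least Py Pv
                    (λ c y≤c c<v → gapR (Fin.suc c) (s<s (ℕP.<-≤-trans k′<y y≤c)) (s<s c<v)) =
      trans (ℤP.+-identityʳ _) (firstPair-spans k′<y)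

  byColumn0 : ∀ k (L : NearestLeft P k) (R : NearestRight P k) →
    (∀ u v → u Fin.< v → f (u , v) ≡ w u v * rCoeff u v k) →
    sumPairs f (filter P? (Fin.zero ∷ map Fin.suc (allFin n))) ≡ pairCoeff (P? k) L R w
  byColumn0 Fin.zero (leftAt _ () _ _) R f≡
  byColumn0 Fin.zero (noLeft _) R f≡ with P? Fin.zero
  ... | no _ = trans dropping0 (shifted-at-0 f≡)
  ... | yes _ = begin
      sumPairs f (Fin.zero ∷ filter P? (map Fin.suc (allFin n)))  ≡⟨ keeping0 ⟩
      firstPair zs + sumPairs fs zs                               ≡⟨ cong₂ _+_ (firstPair-at-0 f≡ refl R) (shifted-at-0 f≡) ⟩
      atRight R (w Fin.zero) + + 0                                ≡⟨ ℤP.+-identityʳ _ ⟩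
      atRight R (w Fin.zero)                                        ≡⟨ sym (ℤP.+-identityˡ _) ⟩
      + 0 + atRight R (w Fin.zero)                                ∎
  byColumn0 (Fin.suc k′) L R f≡ with P? Fin.zero
  ... | no ¬P0 = begin
      sumPairs f (filter P? (map Fin.suc (allFin n)))                        ≡⟨ dropping0 ⟩
      sumPairs fs zs                                                         ≡⟨ shifted ⟩
      pairCoeff (P? (Fin.suc k′)) (shiftLeft L) (shiftRight R) ws            ≡⟨ sym (pairCoeff-shift w (P? (Fin.suc k′)) L R (notAt0 L)) ⟩
      pairCoeff (P? (Fin.suc k′)) L R w                                      ∎
    where
    shifted = sumPairs-coeff n (P? ∘ Fin.suc) k′ (shiftLeft L) (shiftRight R) ws fs (λ u v u<v → f≡ _ _ (s<s u<v))
    notAt0 : (L : NearestLeft P (Fin.suc k′)) → NotAtZero L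
    notAt0 (leftAt Fin.zero _ P0 _) = ¬P0 P0
    notAt0 (leftAt (Fin.suc _) _ _ _) = _
    notAt0 (noLeft _) = _
  ... | yes P0 = begin
      sumPairs f (Fin.zero ∷ filter P? (map Fin.suc (allFin n)))                        ≡⟨ keeping0 ⟩
      firstPair zs + sumPairs fs zs                                                   ≡⟨ cong (λ z → firstPair zs + z) shifted ⟩
      firstPair zs + pairCoeff (P? (Fin.suc k′)) (shiftLeft L) (shiftRight R) ws      ≡⟨ withColumn0 k′ f≡ P0 L R refl ⟩
      pairCoeff (P? (Fin.suc k′)) L R w                                                 ∎
    where
    shifted = sumPairs-coeff n (P? ∘ Fin.suc) k′ (shiftLeft L) (shiftRight R) ws fs (λ u v u<v → f≡ _ _ (s<s u<v))

sumBelow : ℕ → (ℕ → ℤ) → ℤ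
sumBelow zero g = + 0
sumBelow (suc m) g = sumBelow m g + g m

sumℤ-++ : ∀ xs ys → sumℤ (xs List.++ ys) ≡ sumℤ xs + sumℤ ys
sumℤ-++ [] ys = sym (ℤP.+-identityˡ _)
sumℤ-++ (x ∷ xs) ys = trans (cong (λ z → x + z) (sumℤ-++ xs ys)) (sym (ℤP.+-assoc x _ _))

sumℤ-upTo : ∀ m (g : ℕ → ℤ) → sumℤ (map g (List.upTo m)) ≡ sumBelow m g
sumℤ-upTo zero g = refl
sumℤ-upTo (suc m) g = begin
    sumℤ (map g (List.upTo (suc m)))                ≡⟨ cong (sumℤ ∘ map g) (sym (LP.upTo-∷ʳ m)) ⟩
    sumℤ (map g (List.upTo m List.∷ʳ m))            ≡⟨ cong sumℤ (LP.map-++ g (List.upTo m) (m ∷ [])) ⟩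
    sumℤ (map g (List.upTo m) List.++ (g m ∷ []))   ≡⟨ sumℤ-++ (map g (List.upTo m)) (g m ∷ []) ⟩
    sumℤ (map g (List.upTo m)) + (g m + + 0)        ≡⟨ cong₂ _+_ (sumℤ-upTo m g) (ℤP.+-identityʳ (g m)) ⟩
    sumBelow m g + g m                              ∎
  where open ≡-Reasoning

sumBelow-+ : ∀ a m g → sumBelow (a ℕ.+ m) g ≡ sumBelow a g + sumBelow m (λ x → g (a ℕ.+ x))
sumBelow-+ a zero g rewrite ℕP.+-identityʳ a = sym (ℤP.+-identityʳ _)
sumBelow-+ a (suc m) g rewrite ℕP.+-suc a m =
  trans (cong (_+ g (a ℕ.+ m)) (sumBelow-+ a m g)) (ℤP.+-assoc (sumBelow a g) _ _)

sumBelow-front : ∀ m g → sumBelow (suc m) g ≡ g 0 + sumBelow m (g ∘ suc)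
sumBelow-front zero g = trans (ℤP.+-identityˡ (g 0)) (sym (ℤP.+-identityʳ (g 0)))
sumBelow-front (suc m) g = trans (cong (_+ g (suc m)) (sumBelow-front m g)) (ℤP.+-assoc (g 0) _ _)

sumBelow-zero : ∀ m g → (∀ x → g x ≡ + 0) → sumBelow m g ≡ + 0
sumBelow-zero zero g g≡0 = refl
sumBelow-zero (suc m) g g≡0 = cong₂ _+_ (sumBelow-zero m g g≡0) (g≡0 m)

sumF-map : ∀ {t} {A : Set} (φ : A → Form t) (xs : List A) k i →
  sumF (map φ xs) k i ≡ sumℤ (map (λ a → φ a k i) xs)
sumF-map φ [] k i = refl
sumF-map φ (x ∷ xs) k i = cong (λ z → φ x k i + z) (sumF-map φ xs k i)

rDiff-< : ∀ {t} (u v k : Fin (suc t)) → u Fin.< v → rDiff u v k ≡ rCoeff u v k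
rDiff-< u v k u<v with u Fin.<? v
... | yes _ = rPos≡rCoeff u v k
... | no u≮v = ⊥-elim (u≮v u<v)

rDiff-> : ∀ {t} (u v k : Fin (suc t)) → u Fin.< v → rDiff v u k ≡ - rCoeff u v k
rDiff-> u v k u<v with v Fin.<? u
... | yes v<u = ⊥-elim (ℕP.<-asym u<v v<u)
... | no _ = cong -_ (rPos≡rCoeff u v k)

module LevelCoefficients {t} (d : Diagram t) (b : Fin (suc t) → ℕ → Fin t) where
  open ≡-Reasoning

  Col : Set
  Col = Fin (suc t)

  Reaches : ℕ → Col → Set
  Reaches s c = s ℕ.≤ d c

  reaches? : (s : ℕ) → Decidable (Reaches s)
  reaches? s c = s ℕ.≤? d c

  leftNb : (s : ℕ) (k : Col) → NearestLeft (Reaches s) k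
  leftNb s = nearestLeft (reaches? s)

  rightNb : (s : ℕ) (k : Col) → NearestRight (Reaches s) k
  rightNb s = nearestRight (reaches? s)

  entry : Fin t → Col → ℕ → ℤ
  entry i x s = δ i (b x s)

  -- The weight of a consecutive pair u < v at level s: f_{R_s} contains
  -- c_{b(u,s)} (r^u − r^v) at odd and c_{b(v,s)} (r^v − r^u) = −c_{b(v,s)} (r^u − r^v) at even s.
  weight : Bool → ℕ → Fin t → Col → Col → ℤ
  weight true s i u v = - entry i v s
  weight false s i u v = entry i u s

  levelCoeff : ℕ → Col → Fin t → ℤ
  levelCoeff s k i = pairCoeff (reaches? s k) (leftNb s k) (rightNb s k) (weight (isEven s) s i)

  fR≡levelCoeff : ∀ s k i → fR d b s k i ≡ levelCoeff s k i
  fR≡levelCoeff s k i with isEven s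
  ... | true = trans (sumF-map _ (consecutive (columnsAt d s)) k i)
          (sumPairs-coeff (suc t) (reaches? s) k (leftNb s k) (rightNb s k) (weight true s i) _
            (λ u v u<v → begin
               entry i v s * rDiff v u k        ≡⟨ cong (entry i v s *_) (rDiff-> u v k u<v) ⟩
               entry i v s * (- rCoeff u v k)   ≡⟨ sym (ℤP.neg-distribʳ-* (entry i v s) (rCoeff u v k)) ⟩
               - (entry i v s * rCoeff u v k)   ≡⟨ ℤP.neg-distribˡ-* (entry i v s) (rCoeff u v k) ⟩
               (- entry i v s) * rCoeff u v k   ∎))
  ... | false = trans (sumF-map _ (consecutive (columnsAt d s)) k i)
          (sumPairs-coeff (suc t) (reaches? s) k (leftNb s k) (rightNb s k) (weight false s i) _
            (λ u v u<v → cong (entry i u s *_) (rDiff-< u v k u<v)))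

  fT≡levels : ∀ k i → fT d b k i ≡ - δ (Fin.inject₁ i) k + sumBelow (height d) (λ s → levelCoeff (suc s) k i)
  fT≡levels k i = cong (λ z → - δ (Fin.inject₁ i) k + z) (begin
    sumF (map (λ s → fR d b (suc s)) (List.upTo (height d))) k i      ≡⟨ sumF-map (λ s → fR d b (suc s)) (List.upTo (height d)) k i ⟩
    sumℤ (map (λ s → fR d b (suc s) k i) (List.upTo (height d)))      ≡⟨ cong sumℤ (LP.map-cong (λ s → fR≡levelCoeff (suc s) k i) (List.upTo (height d))) ⟩
    sumℤ (map (λ s → levelCoeff (suc s) k i) (List.upTo (height d)))  ≡⟨ sumℤ-upTo (height d) (λ s → levelCoeff (suc s) k i) ⟩
    sumBelow (height d) (λ s → levelCoeff (suc s) k i)                ∎)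

maxF-ub : ∀ {n} (f : Fin n → ℕ) i → f i ℕ.≤ maxF f
maxF-ub f Fin.zero = ℕP.m≤m⊔n _ _
maxF-ub f (Fin.suc i) = ℕP.≤-trans (maxF-ub (f ∘ Fin.suc) i) (ℕP.m≤n⊔m _ _)

parity : ∀ s → Even s ⊎ Odd s
parity s with isEven s
... | true = inj₁ refl
... | false = inj₂ refl

even∧odd : ∀ m → Even m → Odd m → ⊥
even∧odd m e o with trans (sym e) o
... | ()

δ-toℕ : ∀ {n n′} (x y : Fin n) (x′ y′ : Fin n′) → toℕ x ≡ toℕ x′ → toℕ y ≡ toℕ y′ → δ x y ≡ δ x′ y′
δ-toℕ x y x′ y′ x≡x′ y≡y′ rewrite ≟-toℕ x y | ≟-toℕ x′ y′ | x≡x′ | y≡y′ = refl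

δ-refl : ∀ {n} (x : Fin n) → δ x x ≡ + 1
δ-refl x rewrite ≟-toℕ x x | dec-true (toℕ x ℕ.≟ toℕ x) refl = refl

δ-≢ : ∀ {n} (x y : Fin n) → toℕ x ≢ toℕ y → δ x y ≡ + 0
δ-≢ x y x≢y rewrite ≟-toℕ x y | dec-false (toℕ x ℕ.≟ toℕ y) x≢y = refl

δ-sym : ∀ {n} (x y : Fin n) → δ x y ≡ δ y x
δ-sym x y with x ≟ y | y ≟ x
... | yes _ | yes _ = refl
... | no _ | no _ = refl
... | yes x≡y | no y≢x = ⊥-elim (y≢x (sym x≡y))
... | no x≢y | yes y≡x = ⊥-elim (x≢y (sym y≡x))

∣unit*δ∣≤1 : ∀ {n} (σ : ℤ) → ∣ σ ∣ ≡ 1 → (x y : Fin n) → ∣ σ * δ x y ∣ ℕ.≤ 1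
∣unit*δ∣≤1 σ ∣σ∣≡1 x y rewrite ℤP.abs-* σ (δ x y) | ∣σ∣≡1 | ℕP.*-identityˡ ∣ δ x y ∣ with x ≟ y
... | yes _ = ℕP.≤-refl
... | no _ = z≤n

∣sgnDiff∣≡1 : ∀ {n} (k j : Fin n) → ∣ sgnDiff k j ∣ ≡ 1
∣sgnDiff∣≡1 k j with j Fin.<? k
... | yes _ = refl
... | no _ = refl

odd⇒positive : ∀ {m} → Odd m → 1 ℕ.≤ m
odd⇒positive {suc m} _ = s≤s z≤n

module CompleteTableau {t} (d : Diagram t) (b : Fin (suc t) → ℕ → Fin t)
  (boundary : Boundary d) (complete : Complete d) (tableau : IsTableau d b) where
  open LevelCoefficients d b public
  open ≡-Reasoning

  H : ℕ
  H = height d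

  height≤H : ∀ c → d c ℕ.≤ H
  height≤H = maxF-ub d

  toLeftNb : ∀ {s u k} → u Fin.< k → Reaches s u → Reaches s k →
    (∀ c → u Fin.< c → c Fin.< k → ¬ Reaches s c) → LeftNb d s u k
  toLeftNb {s} {u} {k} u<k su sk gap = u<k , (λ u≡k → ℕP.<⇒≢ u<k (cong toℕ u≡k)) , su , sk , between
    where
    between : ∀ c → (u Fin.< c × c Fin.< k) ⊎ (k Fin.< c × c Fin.< u) → d c ℕ.< s
    between c (inj₁ (u<c , c<k)) = ℕP.≰⇒> (gap c u<c c<k)
    between c (inj₂ (k<c , c<u)) = ⊥-elim (ℕP.<-asym u<k (ℕP.<-trans k<c c<u))

  toRightNb : ∀ {s v k} → k Fin.< v → Reaches s v → Reaches s k →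
    (∀ c → k Fin.< c → c Fin.< v → ¬ Reaches s c) → RightNb d s v k
  toRightNb {s} {v} {k} k<v sv sk gap = k<v , (λ v≡k → ℕP.<⇒≢ k<v (cong toℕ (sym v≡k))) , sv , sk , between
    where
    between : ∀ c → (v Fin.< c × c Fin.< k) ⊎ (k Fin.< c × c Fin.< v) → d c ℕ.< s
    between c (inj₂ (k<c , c<v)) = ℕP.≰⇒> (gap c k<c c<v)
    between c (inj₁ (v<c , c<k)) = ⊥-elim (ℕP.<-asym k<v (ℕP.<-trans v<c c<k))

  toLeftExtremal : ∀ a → (∀ c → c Fin.< a → d c ℕ.< d a) → LeftExtremal d a
  toLeftExtremal a higher (c , c<a , _ , da≤dc , _ , _) = ℕP.<⇒≱ (higher c c<a) da≤dc

  toRightExtremal : ∀ a → (∀ c → a Fin.< c → d c ℕ.< d a) → RightExtremal d a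
  toRightExtremal a higher (c , a<c , _ , da≤dc , _ , _) = ℕP.<⇒≱ (higher c a<c) da≤dc

  entry-level1 : ∀ x → NonExtremal d x 1 → toℕ (b x 1) ≡ toℕ x
  entry-level1 = proj₁ tableau

  entry-odd : ∀ x s y → 1 ℕ.≤ s → NonExtremal d x (suc s) → Odd s → LeftNb d s y x → b x (suc s) ≡ b y s
  entry-odd x s y 1≤s ne = proj₁ (proj₂ tableau x s y 1≤s ne)

  entry-even : ∀ x s y → 1 ℕ.≤ s → NonExtremal d x (suc s) → Even s → RightNb d s y x → b x (suc s) ≡ b y s
  entry-even x s y 1≤s ne = proj₂ (proj₂ tableau x s y 1≤s ne)

  -- Boundary conditions, used below the top of a column k: at an odd level m < h_k,
  -- a column left of k reaching m forces one reaching m+1 (the leftmost column of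
  -- height ≥ m would otherwise be left extremal of odd, non-maximal height);
  -- symmetrically on the right at even levels.
  odd-left-continues : ∀ k m → Odd m → m ℕ.< d k → ∀ u → u Fin.< k → Reaches m u →
    (∀ c → c Fin.< k → ¬ Reaches (suc m) c) → ⊥
  odd-left-continues k m odd m<dk u u<k mu none
    with findLeast (λ c → (c Fin.<? k) ×-dec (m ℕ.≤? d c))
  ... | inj₂ nothing = nothing u (u<k , mu)
  ... | inj₁ (a , (a<k , ma) , least) = excluded (proj₁ (boundary a) (toLeftExtremal a higher))
    where
    da≡m : d a ≡ m
    da≡m = ℕP.≤-antisym (ℕP.≤-pred (ℕP.≰⇒> (none a a<k))) ma
    higher : ∀ c → c Fin.< a → d c ℕ.< d a
    higher c c<a = subst (d c ℕ.<_) (sym da≡m) (ℕP.≰⇒> (λ mc → least c c<a (ℕP.<-trans c<a a<k , mc)))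
    excluded : Even (d a) ⊎ d a ≡ H → ⊥
    excluded (inj₁ even) = even∧odd m (subst Even da≡m even) odd
    excluded (inj₂ maximal) = ℕP.<⇒≱ (subst (ℕ._< d k) (trans (sym da≡m) maximal) m<dk) (height≤H k)

  even-right-continues : ∀ k m → Even m → m ℕ.< d k → ∀ v → k Fin.< v → Reaches m v →
    (∀ c → k Fin.< c → ¬ Reaches (suc m) c) → ⊥
  even-right-continues k m even m<dk v k<v mv none
    with findGreatest (λ c → (k Fin.<? c) ×-dec (m ℕ.≤? d c))
  ... | inj₂ nothing = nothing v (k<v , mv)
  ... | inj₁ (a , (k<a , ma) , greatest) = excluded (proj₂ (boundary a) (toRightExtremal a higher))
    where
    da≡m : d a ≡ m
    da≡m = ℕP.≤-antisym (ℕP.≤-pred (ℕP.≰⇒> (none a k<a))) ma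
    higher : ∀ c → a Fin.< c → d c ℕ.< d a
    higher c a<c = subst (d c ℕ.<_) (sym da≡m) (ℕP.≰⇒> (λ mc → greatest c a<c (ℕP.<-trans k<a a<c , mc)))
    excluded : Odd (d a) ⊎ d a ≡ H → ⊥
    excluded (inj₁ odd) = even∧odd m even (subst Odd da≡m odd)
    excluded (inj₂ maximal) = ℕP.<⇒≱ (subst (ℕ._< d k) (trans (sym da≡m) maximal) m<dk) (height≤H k)

  ownTerm nbrTerm : ℕ → Col → Fin t → ℤ
  ownTerm s k i with isEven s
  ... | true = atLeft (leftNb s k) (λ _ → - entry i k s)
  ... | false = atRight (rightNb s k) (λ _ → entry i k s)
  nbrTerm s k i with isEven s
  ... | true = atRight (rightNb s k) (λ v → - entry i v s)
  ... | false = atLeft (leftNb s k) (λ u → entry i u s)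

  levelCoeff-split : ∀ s k i → Reaches s k → levelCoeff s k i ≡ ownTerm s k i + nbrTerm s k i
  levelCoeff-split s k i sk with isEven s
  ... | true = pairCoeff-reached (reaches? s k) sk (leftNb s k) (rightNb s k)
  ... | false = trans (pairCoeff-reached (reaches? s k) sk (leftNb s k) (rightNb s k))
                      (ℤP.+-comm (atLeft (leftNb s k) (λ u → entry i u s)) _)

  -- Below the top of k the neighbour term of level m cancels k′s own term of level
  -- m+1: by the tableau rule b(k,m+1) is the entry of that same neighbour at level m,
  -- which persists to level m+1 by the boundary conditions.
  neighbour-cancels-own : ∀ k i m → 1 ℕ.≤ m → suc m ℕ.≤ d k → nbrTerm m k i + ownTerm (suc m) k i ≡ + 0
  neighbour-cancels-own k i m 1≤m m<dk with isEven m in parity-m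
  ... | true = evenCase (rightNb m k) (rightNb (suc m) k)
    where
    evenCase : (R : NearestRight (Reaches m) k) (R′ : NearestRight (Reaches (suc m)) k) →
      atRight R (λ v → - entry i v m) + atRight R′ (λ _ → entry i k (suc m)) ≡ + 0
    evenCase (noRight _) (noRight _) = refl
    evenCase (noRight none) (rightAt v′ k<v′ reach _) = ⊥-elim (none v′ k<v′ (ℕP.≤-trans (ℕP.n≤1+n m) reach))
    evenCase (rightAt v k<v mv _) (noRight none) = ⊥-elim (even-right-continues k m parity-m m<dk v k<v mv none)
    evenCase (rightAt v k<v mv gap) (rightAt v′ k<v′ reach _) =
      trans (cong (λ z → - entry i v m + δ i z) same) (ℤP.+-inverseˡ (entry i v m))
      where
      nonExtremal : NonExtremal d k (suc m)
      nonExtremal = s≤s z≤n , m<dk , (λ _ → v′ , k<v′ , reach) , (λ e → ⊥-elim (even∧odd (suc m) e (cong not parity-m)))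
      same : b k (suc m) ≡ b v m
      same = entry-even k m v 1≤m nonExtremal parity-m (toRightNb k<v mv (ℕP.≤-trans (ℕP.n≤1+n m) m<dk) gap)
  ... | false = oddCase (leftNb m k) (leftNb (suc m) k)
    where
    oddCase : (L : NearestLeft (Reaches m) k) (L′ : NearestLeft (Reaches (suc m)) k) →
      atLeft L (λ u → entry i u m) + atLeft L′ (λ _ → - entry i k (suc m)) ≡ + 0
    oddCase (noLeft _) (noLeft _) = refl
    oddCase (noLeft none) (leftAt u′ u′<k reach _) = ⊥-elim (none u′ u′<k (ℕP.≤-trans (ℕP.n≤1+n m) reach))
    oddCase (leftAt u u<k mu _) (noLeft none) = ⊥-elim (odd-left-continues k m parity-m m<dk u u<k mu none)
    oddCase (leftAt u u<k mu gap) (leftAt u′ u′<k reach _) =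
      trans (cong (λ z → entry i u m + - δ i z) same) (ℤP.+-inverseʳ (entry i u m))
      where
      nonExtremal : NonExtremal d k (suc m)
      nonExtremal = s≤s z≤n , m<dk , (λ o → ⊥-elim (even∧odd (suc m) (cong not parity-m) o)) , (λ _ → u′ , u′<k , reach)
      same : b k (suc m) ≡ b u m
      same = entry-odd k m u 1≤m nonExtremal parity-m (toLeftNb u<k mu (ℕP.≤-trans (ℕP.n≤1+n m) m<dk) gap)

  telescope : ∀ k i m → 1 ℕ.≤ m → m ℕ.≤ d k →
    sumBelow m (λ s → levelCoeff (suc s) k i) ≡ ownTerm 1 k i + nbrTerm m k i
  telescope k i (suc zero) _ 1≤dk = trans (ℤP.+-identityˡ _) (levelCoeff-split 1 k i 1≤dk)
  telescope k i (suc (suc m)) _ m+2≤dk = begin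
      sumBelow (suc m) (λ s → levelCoeff (suc s) k i) + levelCoeff (suc (suc m)) k i
    ≡⟨ cong₂ _+_ (telescope k i (suc m) (s≤s z≤n) (ℕP.≤-trans (ℕP.n≤1+n _) m+2≤dk))
                 (levelCoeff-split (suc (suc m)) k i m+2≤dk) ⟩
      (own1 + nbrTerm (suc m) k i) + (ownTerm (suc (suc m)) k i + nbrTerm (suc (suc m)) k i)
    ≡⟨ middle-cancels own1 (nbrTerm (suc m) k i) _ _ (neighbour-cancels-own k i (suc m) (s≤s z≤n) m+2≤dk) ⟩
      own1 + nbrTerm (suc (suc m)) k i
    ∎
    where
    own1 = ownTerm 1 k i
    middle-cancels : ∀ a x y z → x + y ≡ + 0 → (a + x) + (y + z) ≡ a + z
    middle-cancels a x y z x+y≡0 = begin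
      (a + x) + (y + z)  ≡⟨ ℤP.+-assoc a x (y + z) ⟩
      a + (x + (y + z))  ≡⟨ cong (λ w → a + w) (sym (ℤP.+-assoc x y z)) ⟩
      a + ((x + y) + z)  ≡⟨ cong (λ w → a + (w + z)) x+y≡0 ⟩
      a + (+ 0 + z)      ≡⟨ cong (λ w → a + w) (ℤP.+-identityˡ z) ⟩
      a + z              ∎

  -- The last column C_{t+1} is right extremal, so it has odd or maximal height;
  -- in particular it reaches level 1 in a non-empty diagram.
  last : Col
  last = Fin.fromℕ t

  toℕ-last : toℕ last ≡ t
  toℕ-last = FinP.toℕ-fromℕ t

  toℕ≤t : ∀ (c : Col) → toℕ c ℕ.≤ t
  toℕ≤t c = ℕP.≤-pred (FinP.toℕ<n c)

  last-right-extremal : RightExtremal d last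
  last-right-extremal = toRightExtremal last
    (λ c last<c → ⊥-elim (ℕP.<⇒≱ (subst (ℕ._< toℕ c) toℕ-last last<c) (toℕ≤t c)))

  last-reaches-1 : 1 ℕ.≤ H → 1 ℕ.≤ d last
  last-reaches-1 1≤H with proj₂ (boundary last) last-right-extremal
  ... | inj₁ odd = odd⇒positive odd
  ... | inj₂ maximal = subst (1 ℕ.≤_) (sym maximal) 1≤H

  -- The term −c_k of h cancels the own term c_{b(k,1)} = c_k of level 1; for the last
  -- column, which has no right neighbour, m^{t+1} does not occur in h at all.
  h-cancels-own : ∀ k i → 1 ℕ.≤ d k → - δ (Fin.inject₁ i) k + ownTerm 1 k i ≡ + 0
  h-cancels-own k i 1≤dk with rightNb 1 k
  ... | rightAt v k<v reach _ =
    trans (cong (λ z → - z + δ i (b k 1)) same) (ℤP.+-inverseˡ (δ i (b k 1)))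
    where
    nonExtremal : NonExtremal d k 1
    nonExtremal = s≤s z≤n , 1≤dk , (λ _ → v , k<v , reach) , (λ ())
    same : δ (Fin.inject₁ i) k ≡ δ i (b k 1)
    same = δ-toℕ (Fin.inject₁ i) k i (b k 1) (FinP.toℕ-inject₁ i) (sym (entry-level1 k nonExtremal))
  ... | noRight none = cong (λ z → - z + + 0) (δ-≢ (Fin.inject₁ i) k inject≢k)
    where
    k-is-last : toℕ k ≡ t
    k-is-last = ℕP.≤∧≮⇒≡ (toℕ≤t k) (λ k<t →
      none last (subst (toℕ k ℕ.<_) (sym toℕ-last) k<t) (last-reaches-1 (ℕP.≤-trans 1≤dk (height≤H k))))
    inject≢k : toℕ (Fin.inject₁ i) ≢ toℕ k
    inject≢k e = ℕP.<⇒≢ (FinP.toℕ<n i) (trans (sym (FinP.toℕ-inject₁ i)) (trans e k-is-last))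

  -- u (resp. v) is the nearest column left (right) of k reaching level s; unlike the
  -- neighbour relation of the paper, k itself need not reach level s.
  IsLeftNb IsRightNb : ℕ → Col → Col → Set
  IsLeftNb s k u = u Fin.< k × Reaches s u × (∀ c → u Fin.< c → c Fin.< k → ¬ Reaches s c)
  IsRightNb s k v = k Fin.< v × Reaches s v × (∀ c → k Fin.< c → c Fin.< v → ¬ Reaches s c)

  leftNb-greatest : ∀ {s k u c} → IsLeftNb s k u → c Fin.< k → Reaches s c → c Fin.≤ u
  leftNb-greatest (u<k , _ , gap) c<k sc = ℕP.≮⇒≥ (λ u<c → gap _ u<c c<k sc)

  rightNb-least : ∀ {s k v c} → IsRightNb s k v → k Fin.< c → Reaches s c → v Fin.≤ c
  rightNb-least (k<v , _ , gap) k<c sc = ℕP.≮⇒≥ (λ c<v → gap _ k<c c<v sc)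

  leftNb-unique : ∀ {s k u u′} → IsLeftNb s k u → IsLeftNb s k u′ → u ≡ u′
  leftNb-unique nb nb′ = toℕ-injective (ℕP.≤-antisym
    (leftNb-greatest nb′ (proj₁ nb) (proj₁ (proj₂ nb))) (leftNb-greatest nb (proj₁ nb′) (proj₁ (proj₂ nb′))))

  rightNb-unique : ∀ {s k v v′} → IsRightNb s k v → IsRightNb s k v′ → v ≡ v′
  rightNb-unique nb nb′ = toℕ-injective (ℕP.≤-antisym
    (rightNb-least nb (proj₁ nb′) (proj₁ (proj₂ nb′))) (rightNb-least nb′ (proj₁ nb) (proj₁ (proj₂ nb))))

  getLeftNb : ∀ s k c → c Fin.< k → Reaches s c → Σ Col (IsLeftNb s k)
  getLeftNb s k c c<k sc with leftNb s k
  ... | leftAt u u<k su gap = u , u<k , su , gap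
  ... | noLeft none = ⊥-elim (none c c<k sc)

  getRightNb : ∀ s k c → k Fin.< c → Reaches s c → Σ Col (IsRightNb s k)
  getRightNb s k c k<c sc with rightNb s k
  ... | rightAt v k<v sv gap = v , k<v , sv , gap
  ... | noRight none = ⊥-elim (none c k<c sc)

  isLeftNb⇒LeftNb : ∀ {s k u} → IsLeftNb s k u → Reaches s k → LeftNb d s u k
  isLeftNb⇒LeftNb (u<k , su , gap) sk = toLeftNb u<k su sk gap

  isRightNb⇒RightNb : ∀ {s k v} → IsRightNb s k v → Reaches s k → RightNb d s v k
  isRightNb⇒RightNb (k<v , sv , gap) sk = toRightNb k<v sv sk gap

  -- Position of the entries: at an odd level  x ≤ b(x,s) < (right neighbour of x),
  -- at an even level  (left neighbour of x) ≤ b(x,s) < x.  (Entries are copied from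
  -- the right neighbour at even levels and from the left one at odd levels.)
  EntryBounds : ℕ → Set
  EntryBounds s = ∀ x → NonExtremal d x s →
    (Odd s → toℕ x ℕ.≤ toℕ (b x s) × (∀ y → IsRightNb s x y → toℕ (b x s) ℕ.< toℕ y)) ×
    (Even s → toℕ (b x s) ℕ.< toℕ x × (∀ y → IsLeftNb s x y → toℕ y ℕ.≤ toℕ (b x s)))

  entryBounds-1 : EntryBounds 1
  entryBounds-1 x ne =
    (λ _ → ℕP.≤-reflexive (sym (entry-level1 x ne)) , λ y (x<y , _) → subst (ℕ._< toℕ y) (sym (entry-level1 x ne)) x<y) ,
    (λ ())

  entryBounds-suc : ∀ s → 1 ℕ.≤ s → EntryBounds s → EntryBounds (suc s)
  entryBounds-suc s 1≤s ih x ne@(_ , s+1≤dx , hasRight , hasLeft) with parity s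
  ... | inj₁ even = (λ _ → lower , upper) , (λ e → ⊥-elim (even∧odd (suc s) e (cong not even)))
    where
    sx = ℕP.≤-trans (ℕP.n≤1+n s) s+1≤dx
    witness = hasRight (cong not even)
    r-found = getRightNb s x (proj₁ witness) (proj₁ (proj₂ witness)) (ℕP.≤-trans (ℕP.n≤1+n s) (proj₂ (proj₂ witness)))
    r = proj₁ r-found
    isR = proj₂ r-found
    copied : b x (suc s) ≡ b r s
    copied = entry-even x s r 1≤s ne even (isRightNb⇒RightNb isR sx)
    boundsR = proj₂ (ih r (1≤s , proj₁ (proj₂ isR) , (λ o → ⊥-elim (even∧odd s even o)) , (λ _ → x , proj₁ isR , sx))) even
    lower : toℕ x ℕ.≤ toℕ (b x (suc s))
    lower = subst (λ z → toℕ x ℕ.≤ toℕ z) (sym copied) (proj₂ boundsR x (proj₁ isR , sx , proj₂ (proj₂ isR)))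
    upper : ∀ y → IsRightNb (suc s) x y → toℕ (b x (suc s)) ℕ.< toℕ y
    upper y (x<y , reach , _) = subst (λ z → toℕ z ℕ.< toℕ y) (sym copied)
      (ℕP.<-≤-trans (proj₁ boundsR) (rightNb-least isR x<y (ℕP.≤-trans (ℕP.n≤1+n s) reach)))
  ... | inj₂ odd = (λ o → ⊥-elim (even∧odd (suc s) (cong not odd) o)) , (λ _ → upper , lower)
    where
    sx = ℕP.≤-trans (ℕP.n≤1+n s) s+1≤dx
    witness = hasLeft (cong not odd)
    l-found = getLeftNb s x (proj₁ witness) (proj₁ (proj₂ witness)) (ℕP.≤-trans (ℕP.n≤1+n s) (proj₂ (proj₂ witness)))
    l = proj₁ l-found
    isL = proj₂ l-found
    copied : b x (suc s) ≡ b l s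
    copied = entry-odd x s l 1≤s ne odd (isLeftNb⇒LeftNb isL sx)
    boundsL = proj₁ (ih l (1≤s , proj₁ (proj₂ isL) , (λ _ → x , proj₁ isL , sx) , (λ e → ⊥-elim (even∧odd s e odd)))) odd
    upper : toℕ (b x (suc s)) ℕ.< toℕ x
    upper = subst (λ z → toℕ z ℕ.< toℕ x) (sym copied) (proj₂ boundsL x (proj₁ isL , sx , proj₂ (proj₂ isL)))
    lower : ∀ y → IsLeftNb (suc s) x y → toℕ y ℕ.≤ toℕ (b x (suc s))
    lower y (y<x , reach , _) = subst (λ z → toℕ y ℕ.≤ toℕ z) (sym copied)
      (ℕP.≤-trans (leftNb-greatest isL y<x (ℕP.≤-trans (ℕP.n≤1+n s) reach)) (proj₁ boundsL))

  entryBounds : ∀ s → 1 ℕ.≤ s → EntryBounds s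
  entryBounds (suc zero) _ = entryBounds-1
  entryBounds (suc (suc s)) _ = entryBounds-suc (suc s) (s≤s z≤n) (entryBounds (suc s) (s≤s z≤n))

  adjoin-self : ∀ a → adjoin d a a ≡ suc (suc (d a))
  adjoin-self a with a ≟ a
  ... | yes _ = refl
  ... | no a≢a = ⊥-elim (a≢a refl)

  adjoin-other : ∀ a c → c ≢ a → adjoin d a c ≡ d c
  adjoin-other a c c≢a with c ≟ a
  ... | yes c≡a = ⊥-elim (c≢a c≡a)
  ... | no _ = refl

  <⇒≢ : ∀ {x y : Col} → x Fin.< y → x ≢ y
  <⇒≢ x<y x≡y = ℕP.<⇒≢ x<y (cong toℕ x≡y)

  no-left-even-domino : ∀ a c → Even (d a) → a Fin.< c → suc (suc (d a)) ℕ.≤ d c →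
    (∀ x → a Fin.< x → x Fin.< c → d x ℕ.< suc (d a)) → ⊥
  no-left-even-domino a c even a<c high gap =
    proj₁ complete (a , even , c , high , leftNbAt (suc (d a)) (ℕP.n≤1+n _) ℕP.≤-refl ,
                                          leftNbAt (suc (suc (d a))) ℕP.≤-refl (ℕP.n≤1+n _))
    where
    leftNbAt : ∀ s → s ℕ.≤ suc (suc (d a)) → suc (d a) ℕ.≤ s → LeftNb (adjoin d a) s a c
    leftNbAt s s≤ s≥ = a<c , <⇒≢ a<c , subst (s ℕ.≤_) (sym (adjoin-self a)) s≤ ,
      subst (s ℕ.≤_) (sym (adjoin-other a c (<⇒≢ a<c ∘ sym))) (ℕP.≤-trans s≤ high) , between
      where
      between : ∀ x → (a Fin.< x × x Fin.< c) ⊎ (c Fin.< x × x Fin.< a) → adjoin d a x ℕ.< s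
      between x (inj₁ (a<x , x<c)) =
        subst (ℕ._< s) (sym (adjoin-other a x (<⇒≢ a<x ∘ sym))) (ℕP.<-≤-trans (gap x a<x x<c) s≥)
      between x (inj₂ (c<x , x<a)) = ⊥-elim (ℕP.<-asym a<c (ℕP.<-trans c<x x<a))

  no-right-odd-domino : ∀ a c → Odd (d a) → c Fin.< a → suc (suc (d a)) ℕ.≤ d c →
    (∀ x → c Fin.< x → x Fin.< a → d x ℕ.< suc (d a)) → ⊥
  no-right-odd-domino a c odd c<a high gap =
    proj₂ complete (a , odd , c , high , rightNbAt (suc (d a)) (ℕP.n≤1+n _) ℕP.≤-refl ,
                                         rightNbAt (suc (suc (d a))) ℕP.≤-refl (ℕP.n≤1+n _))
    where
    rightNbAt : ∀ s → s ℕ.≤ suc (suc (d a)) → suc (d a) ℕ.≤ s → RightNb (adjoin d a) s a c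
    rightNbAt s s≤ s≥ = c<a , <⇒≢ c<a ∘ sym , subst (s ℕ.≤_) (sym (adjoin-self a)) s≤ ,
      subst (s ℕ.≤_) (sym (adjoin-other a c (<⇒≢ c<a))) (ℕP.≤-trans s≤ high) , between
      where
      between : ∀ x → (a Fin.< x × x Fin.< c) ⊎ (c Fin.< x × x Fin.< a) → adjoin d a x ℕ.< s
      between x (inj₂ (c<x , x<a)) =
        subst (ℕ._< s) (sym (adjoin-other a x (<⇒≢ x<a))) (ℕP.<-≤-trans (gap x c<x x<a) s≥)
      between x (inj₁ (a<x , x<c)) = ⊥-elim (ℕP.<-asym c<a (ℕP.<-trans a<x x<c))

  height-exactly : ∀ {x s} → suc s ℕ.≤ x → ¬ (suc (suc s) ℕ.≤ x) → x ≡ suc s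
  height-exactly s+1≤x s+2≰x = ℕP.≤-antisym (ℕP.≤-pred (ℕP.≰⇒> s+2≰x)) s+1≤x

  -- Induction on s; each step is a forbidden domino on the neighbour of the
  -- level below (on k itself at level h_k + 1).
  staircase : ∀ k s → d k ℕ.< s → ∀ u v → IsLeftNb s k u → IsRightNb s k v →
    (Odd s → d v ≡ s) × (Even s → d u ≡ s)
  staircase k (suc s) dk<s+1 u v isU isV with s ℕ.≟ d k
  ... | yes refl with parity (d k)
  ...   | inj₁ even =
          (λ _ → height-exactly (proj₁ (proj₂ isV)) (λ high → no-left-even-domino k v even (proj₁ isV) high
                   (λ c k<c c<v → ℕP.≰⇒> (proj₂ (proj₂ isV) c k<c c<v)))) ,
          (λ e → ⊥-elim (even∧odd (suc (d k)) e (cong not even)))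
  ...   | inj₂ odd =
          (λ o → ⊥-elim (even∧odd (suc (d k)) (cong not odd) o)) ,
          (λ _ → height-exactly (proj₁ (proj₂ isU)) (λ high → no-right-odd-domino k u odd (proj₁ isU) high
                   (λ c u<c c<k → ℕP.≰⇒> (proj₂ (proj₂ isU) c u<c c<k))))
  staircase k (suc s) dk<s+1 u v isU isV | no s≢dk = step (parity s)
    where
    dk<s : d k ℕ.< s
    dk<s = ℕP.≤∧≢⇒< (ℕP.≤-pred dk<s+1) (s≢dk ∘ sym)
    u₀-found = getLeftNb s k u (proj₁ isU) (ℕP.≤-trans (ℕP.n≤1+n s) (proj₁ (proj₂ isU)))
    v₀-found = getRightNb s k v (proj₁ isV) (ℕP.≤-trans (ℕP.n≤1+n s) (proj₁ (proj₂ isV)))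
    u₀ = proj₁ u₀-found
    v₀ = proj₁ v₀-found
    below = staircase k s dk<s u₀ v₀ (proj₂ u₀-found) (proj₂ v₀-found)
    step : Even s ⊎ Odd s → (Odd (suc s) → d v ≡ suc s) × (Even (suc s) → d u ≡ suc s)
    step (inj₂ odd) = (λ o → ⊥-elim (even∧odd (suc s) (cong not odd) o)) ,
      (λ _ → height-exactly (proj₁ (proj₂ isU)) (λ high → no-right-odd-domino v₀ u (subst Odd (sym dv₀) odd)
               (ℕP.<-trans (proj₁ isU) (proj₁ (proj₂ v₀-found))) (subst (λ z → suc (suc z) ℕ.≤ d u) (sym dv₀) high) gap))
      where
      dv₀ : d v₀ ≡ s
      dv₀ = proj₁ below odd
      gap : ∀ c → u Fin.< c → c Fin.< v₀ → d c ℕ.< suc (d v₀)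
      gap c u<c c<v₀ rewrite dv₀ with <-cmp c k
      ... | tri< c<k _ _ = ℕP.≰⇒> (proj₂ (proj₂ isU) c u<c c<k)
      ... | tri≈ _ refl _ = ℕP.<-trans dk<s (ℕP.n<1+n s)
      ... | tri> _ _ k<c = ℕP.<-trans (ℕP.≰⇒> (proj₂ (proj₂ (proj₂ v₀-found)) c k<c c<v₀)) (ℕP.n<1+n s)
    step (inj₁ even) = (λ _ → height-exactly (proj₁ (proj₂ isV)) (λ high → no-left-even-domino u₀ v (subst Even (sym du₀) even)
               (ℕP.<-trans (proj₁ (proj₂ u₀-found)) (proj₁ isV)) (subst (λ z → suc (suc z) ℕ.≤ d v) (sym du₀) high) gap)) ,
      (λ e → ⊥-elim (even∧odd (suc s) e (cong not even)))
      where
      du₀ : d u₀ ≡ s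
      du₀ = proj₂ below even
      gap : ∀ c → u₀ Fin.< c → c Fin.< v → d c ℕ.< suc (d u₀)
      gap c u₀<c c<v rewrite du₀ with <-cmp c k
      ... | tri< c<k _ _ = ℕP.<-trans (ℕP.≰⇒> (proj₂ (proj₂ (proj₂ u₀-found)) c u₀<c c<k)) (ℕP.n<1+n s)
      ... | tri≈ _ refl _ = ℕP.<-trans dk<s (ℕP.n<1+n s)
      ... | tri> _ _ k<c = ℕP.≰⇒> (proj₂ (proj₂ isV) c k<c c<v)

  entry-above-left : ∀ k s → Even s → d k ℕ.< s → ∀ u v → IsLeftNb (suc s) k u → IsRightNb (suc s) k v →
    Σ Col (λ u₀ → IsLeftNb s k u₀ × toℕ (b u (suc s)) ℕ.< toℕ u₀)
  entry-above-left k s even dk<s u v (u<k , s+1≤du , _) (k<v , s+1≤dv , _) = u₀ , isU₀ , entry<u₀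
    where
    1≤s = ℕP.≤-trans (s≤s z≤n) dk<s
    s≤du = ℕP.≤-trans (ℕP.n≤1+n s) s+1≤du
    u₀-found = getLeftNb s k u u<k s≤du
    u₀ = proj₁ u₀-found
    isU₀ = proj₂ u₀-found
    du₀≡s : d u₀ ≡ s
    du₀≡s = proj₂ (staircase k s dk<s u₀ _ isU₀ (proj₂ (getRightNb s k v k<v (ℕP.≤-trans (ℕP.n≤1+n s) s+1≤dv)))) even
    u<u₀ : u Fin.< u₀
    u<u₀ = ℕP.≤∧≢⇒< (leftNb-greatest isU₀ u<k s≤du)
      (λ u≡u₀ → ℕP.<⇒≱ (subst (ℕ._< suc s) (sym du₀≡s) (ℕP.n<1+n s)) (subst (λ c → suc s ℕ.≤ d c) (toℕ-injective u≡u₀) s+1≤du))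
    r-found = getRightNb s u u₀ u<u₀ (proj₁ (proj₂ isU₀))
    r = proj₁ r-found
    isR = proj₂ r-found
    copied : b u (suc s) ≡ b r s
    copied = entry-even u s r 1≤s (s≤s z≤n , s+1≤du , (λ _ → v , ℕP.<-trans u<k k<v , s+1≤dv) ,
                                    (λ e → ⊥-elim (even∧odd (suc s) e (cong not even))))
               even (isRightNb⇒RightNb isR s≤du)
    entry<r : toℕ (b r s) ℕ.< toℕ r
    entry<r = proj₁ (proj₂ (entryBounds s 1≤s r (1≤s , proj₁ (proj₂ isR) ,
                (λ o → ⊥-elim (even∧odd s even o)) , (λ _ → u , proj₁ isR , s≤du))) even)
    entry<u₀ : toℕ (b u (suc s)) ℕ.< toℕ u₀
    entry<u₀ = subst (λ z → toℕ z ℕ.< toℕ u₀) (sym copied)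
                 (ℕP.<-≤-trans entry<r (rightNb-least isR u<u₀ (proj₁ (proj₂ isU₀))))

  entry-above-right : ∀ k s → Odd s → d k ℕ.< s → ∀ u v → IsLeftNb (suc s) k u → IsRightNb (suc s) k v →
    Σ Col (λ v₀ → IsRightNb s k v₀ × toℕ v₀ ℕ.≤ toℕ (b v (suc s)))
  entry-above-right k s odd dk<s u v (u<k , s+1≤du , _) (k<v , s+1≤dv , _) = v₀ , isV₀ , v₀≤entry
    where
    1≤s = ℕP.≤-trans (s≤s z≤n) dk<s
    s≤dv = ℕP.≤-trans (ℕP.n≤1+n s) s+1≤dv
    v₀-found = getRightNb s k v k<v s≤dv
    v₀ = proj₁ v₀-found
    isV₀ = proj₂ v₀-found
    dv₀≡s : d v₀ ≡ s
    dv₀≡s = proj₁ (staircase k s dk<s _ v₀ (proj₂ (getLeftNb s k u u<k (ℕP.≤-trans (ℕP.n≤1+n s) s+1≤du))) isV₀) odd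
    v₀<v : v₀ Fin.< v
    v₀<v = ℕP.≤∧≢⇒< (rightNb-least isV₀ k<v s≤dv)
      (λ v₀≡v → ℕP.<⇒≱ (subst (ℕ._< suc s) (sym dv₀≡s) (ℕP.n<1+n s)) (subst (λ c → suc s ℕ.≤ d c) (sym (toℕ-injective v₀≡v)) s+1≤dv))
    l-found = getLeftNb s v v₀ v₀<v (proj₁ (proj₂ isV₀))
    l = proj₁ l-found
    isL = proj₂ l-found
    copied : b v (suc s) ≡ b l s
    copied = entry-odd v s l 1≤s (s≤s z≤n , s+1≤dv ,
                                  (λ o → ⊥-elim (even∧odd (suc s) (cong not odd) o)) , (λ _ → u , ℕP.<-trans u<k k<v , s+1≤du))
               odd (isLeftNb⇒LeftNb isL s≤dv)
    l≤entry : toℕ l ℕ.≤ toℕ (b l s)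
    l≤entry = proj₁ (proj₁ (entryBounds s 1≤s l (1≤s , proj₁ (proj₂ isL) ,
                (λ _ → v , proj₁ isL , s≤dv) , (λ e → ⊥-elim (even∧odd s e odd)))) odd)
    v₀≤entry : toℕ v₀ ℕ.≤ toℕ (b v (suc s))
    v₀≤entry = subst (λ z → toℕ v₀ ℕ.≤ toℕ z) (sym copied)
                 (ℕP.≤-trans (leftNb-greatest isL v₀<v (proj₁ (proj₂ isV₀))) l≤entry)

  fT-split : ∀ k i → fT d b k i ≡ - δ (Fin.inject₁ i) k +
    (sumBelow (d k) (λ s → levelCoeff (suc s) k i) + sumBelow (H ℕ.∸ d k) (λ x → levelCoeff (suc (d k ℕ.+ x)) k i))
  fT-split k i = trans (fT≡levels k i) (cong (λ z → - δ (Fin.inject₁ i) k + z) (begin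
    sumBelow H (λ s → levelCoeff (suc s) k i)                    ≡⟨ cong (λ m → sumBelow m (λ s → levelCoeff (suc s) k i))
                                                                          (sym (ℕP.m+[n∸m]≡n (height≤H k))) ⟩
    sumBelow (d k ℕ.+ (H ℕ.∸ d k)) (λ s → levelCoeff (suc s) k i) ≡⟨ sumBelow-+ (d k) (H ℕ.∸ d k) (λ s → levelCoeff (suc s) k i) ⟩
    _                                                             ∎))

  levelCoeff-above : ∀ s k i → d k ℕ.< s →
    levelCoeff s k i ≡ across (leftNb s k) (rightNb s k) (λ u v → + 2 * weight (isEven s) s i u v)
  levelCoeff-above s k i dk<s = pairCoeff-unreached (reaches? s k) (ℕP.<⇒≱ dk<s) (leftNb s k) (rightNb s k)

  levelCoeff-above-odd : ∀ s k i → Odd s → d k ℕ.< s →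
    levelCoeff s k i ≡ across (leftNb s k) (rightNb s k) (λ u v → + 2 * entry i u s)
  levelCoeff-above-odd s k i odd dk<s =
    subst (λ p → levelCoeff s k i ≡ across (leftNb s k) (rightNb s k) (λ u v → + 2 * weight p s i u v))
          odd (levelCoeff-above s k i dk<s)

  levelCoeff-above-even : ∀ s k i → Even s → d k ℕ.< s →
    levelCoeff s k i ≡ across (leftNb s k) (rightNb s k) (λ u v → + 2 * - entry i v s)
  levelCoeff-above-even s k i even dk<s =
    subst (λ p → levelCoeff s k i ≡ across (leftNb s k) (rightNb s k) (λ u v → + 2 * weight p s i u v))
          even (levelCoeff-above s k i dk<s)

  levelCoeff-above-one-sided : ∀ s k i → d k ℕ.< s →
    (∀ c → c Fin.< k → ¬ Reaches s c) ⊎ (∀ c → k Fin.< c → ¬ Reaches s c) → levelCoeff s k i ≡ + 0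
  levelCoeff-above-one-sided s k i dk<s side =
    trans (levelCoeff-above s k i dk<s) (vanish side (leftNb s k) (rightNb s k))
    where
    vanish : (∀ c → c Fin.< k → ¬ Reaches s c) ⊎ (∀ c → k Fin.< c → ¬ Reaches s c) →
      ∀ L R → across L R (λ u v → + 2 * weight (isEven s) s i u v) ≡ + 0
    vanish _ (noLeft _) R = refl
    vanish _ (leftAt _ _ _ _) (noRight _) = refl
    vanish (inj₁ noneLeft) (leftAt u u<k su _) (rightAt _ _ _ _) = ⊥-elim (noneLeft u u<k su)
    vanish (inj₂ noneRight) (leftAt _ _ _ _) (rightAt v k<v sv _) = ⊥-elim (noneRight v k<v sv)

  -- Column k is at least as high as every column on one of its sides (the shape of a
  -- quasi-extremal column, without reference to the strongly extremal one).
  OneSideLower : Col → Set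
  OneSideLower k = (∀ c → c Fin.< k → d c ℕ.≤ d k) ⊎ (∀ c → k Fin.< c → d c ℕ.≤ d k)

  fT-oneSided : ∀ k → OneSideLower k → ∀ i →
    fT d b k i ≡ - δ (Fin.inject₁ i) k + sumBelow (d k) (λ s → levelCoeff (suc s) k i)
  fT-oneSided k side i = trans (fT-split k i) (cong (λ z → - δ (Fin.inject₁ i) k + z)
    (trans (cong (λ z → sumBelow (d k) (λ s → levelCoeff (suc s) k i) + z)
                 (sumBelow-zero (H ℕ.∸ d k) _ (λ x → levelCoeff-above-one-sided _ k i (above x) (noneAbove side x))))
           (ℤP.+-identityʳ _)))
    where
    above : ∀ x → d k ℕ.< suc (d k ℕ.+ x)
    above x = s≤s (ℕP.m≤m+n (d k) x)
    noneAbove : OneSideLower k → ∀ x →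
      (∀ c → c Fin.< k → ¬ Reaches (suc (d k ℕ.+ x)) c) ⊎ (∀ c → k Fin.< c → ¬ Reaches (suc (d k ℕ.+ x)) c)
    noneAbove (inj₁ lowerLeft) x = inj₁ (λ c c<k reach → ℕP.<⇒≱ (above x) (ℕP.≤-trans reach (lowerLeft c c<k)))
    noneAbove (inj₂ lowerRight) x = inj₂ (λ c k<c reach → ℕP.<⇒≱ (above x) (ℕP.≤-trans reach (lowerRight c k<c)))

  fT-oneSided-top : ∀ k → OneSideLower k → 1 ℕ.≤ d k → ∀ i → fT d b k i ≡ nbrTerm (d k) k i
  fT-oneSided-top k side 1≤dk i = begin
    fT d b k i                                                        ≡⟨ fT-oneSided k side i ⟩
    - δ (Fin.inject₁ i) k + sumBelow (d k) (λ s → levelCoeff (suc s) k i) ≡⟨ cong (λ z → - δ (Fin.inject₁ i) k + z) (telescope k i (d k) 1≤dk ℕP.≤-refl) ⟩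
    - δ (Fin.inject₁ i) k + (ownTerm 1 k i + nbrTerm (d k) k i)        ≡⟨ sym (ℤP.+-assoc (- δ (Fin.inject₁ i) k) _ _) ⟩
    (- δ (Fin.inject₁ i) k + ownTerm 1 k i) + nbrTerm (d k) k i        ≡⟨ cong (_+ nbrTerm (d k) k i) (h-cancels-own k i 1≤dk) ⟩
    + 0 + nbrTerm (d k) k i                                            ≡⟨ ℤP.+-identityˡ _ ⟩
    nbrTerm (d k) k i                                                  ∎

  fT-oneSided-empty : ∀ k → OneSideLower k → d k ≡ 0 → ∀ i → fT d b k i ≡ - δ (Fin.inject₁ i) k
  fT-oneSided-empty k side dk≡0 i = trans (fT-oneSided k side i)
    (trans (cong (λ m → - δ (Fin.inject₁ i) k + sumBelow m (λ s → levelCoeff (suc s) k i)) dk≡0) (ℤP.+-identityʳ _))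

  nbrTerm-odd : ∀ s k i → Odd s → nbrTerm s k i ≡ atLeft (leftNb s k) (λ u → entry i u s)
  nbrTerm-odd s k i odd rewrite odd = refl

  nbrTerm-even : ∀ s k i → Even s → nbrTerm s k i ≡ atRight (rightNb s k) (λ v → - entry i v s)
  nbrTerm-even s k i even rewrite even = refl

  module StronglyExtremalColumn (j : Col) (strongly : StronglyExtremal d j) where
    nonempty : ∀ k → 1 ℕ.≤ d k → H ≢ 0
    nonempty k 1≤dk H≡0 = ℕP.<⇒≱ 1≤dk (subst (d k ℕ.≤_) H≡0 (height≤H k))

    j-top : ∀ k → 1 ℕ.≤ d k → d j ≡ H
    j-top k 1≤dk = top strongly
      where
      top : StronglyExtremal d j → d j ≡ H
      top (inj₁ (H≡0 , _)) = ⊥-elim (nonempty k 1≤dk H≡0)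
      top (inj₂ (inj₁ (_ , _ , dj≡H , _))) = dj≡H
      top (inj₂ (inj₂ (_ , _ , dj≡H , _))) = dj≡H

    j-highest : ∀ k → 1 ℕ.≤ d k → d k ℕ.≤ d j
    j-highest k 1≤dk = subst (d k ℕ.≤_) (sym (j-top k 1≤dk)) (height≤H k)

    SignedSide : Col → Set
    SignedSide k = (Odd (d k) → j Fin.< k × Σ Col (λ c → c Fin.< k × d k ℕ.≤ d c))
                 × (Even (d k) → k Fin.< j × Σ Col (λ c → k Fin.< c × d k ℕ.≤ d c))

    -- For a left quasi-extremal column: the leftmost column of height ≥ h_k has height
    -- h_k and is left extremal, so h_k is even or maximal; the position of C_j decides.
    signedSide-left : ∀ k → k ≢ j → 1 ℕ.≤ d k → (∀ c → c Fin.< k → d c ℕ.≤ d k) → SignedSide k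
    signedSide-left k k≢j 1≤dk lowerLeft with findLeast (λ c → d k ℕ.≤? d c)
    ... | inj₂ none = ⊥-elim (none k ℕP.≤-refl)
    ... | inj₁ (a , dk≤da , least) = bySide strongly (<-cmp k j)
      where
      a≤k : a Fin.≤ k
      a≤k = ℕP.≮⇒≥ (λ k<a → least k k<a ℕP.≤-refl)
      da≡dk : d a ≡ d k
      da≡dk with <-cmp a k
      ... | tri< a<k _ _ = ℕP.≤-antisym (lowerLeft a a<k) dk≤da
      ... | tri≈ _ refl _ = refl
      ... | tri> _ _ k<a = ⊥-elim (ℕP.<⇒≱ k<a a≤k)
      a-even-or-top : Even (d a) ⊎ d a ≡ H
      a-even-or-top = proj₁ (boundary a) (toLeftExtremal a
        (λ c c<a → subst (d c ℕ.<_) (sym da≡dk) (ℕP.≰⇒> (least c c<a))))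
      k-top : j Fin.< k → d k ≡ H
      k-top j<k = ℕP.≤-antisym (height≤H k) (subst (ℕ._≤ d k) (j-top k 1≤dk) (lowerLeft j j<k))
      bySide : StronglyExtremal d j → Tri (k Fin.< j) (k ≡ j) (j Fin.< k) → SignedSide k
      bySide se (tri< k<j _ _) = notOdd se a-even-or-top , (λ _ → k<j , j , k<j , j-highest k 1≤dk)
        where
        notOdd : StronglyExtremal d j → Even (d a) ⊎ d a ≡ H → Odd (d k) → _
        notOdd _ (inj₁ even) odd = ⊥-elim (even∧odd (d k) (subst Even da≡dk even) odd)
        notOdd (inj₁ (H≡0 , _)) (inj₂ _) _ = ⊥-elim (nonempty k 1≤dk H≡0)
        notOdd (inj₂ (inj₁ (_ , _ , _ , leftmost))) (inj₂ da≡H) _ = ⊥-elim (leftmost a (ℕP.≤-<-trans a≤k k<j) da≡H)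
        notOdd (inj₂ (inj₂ (_ , evenH , _ , _))) (inj₂ da≡H) odd =
          ⊥-elim (even∧odd (d k) (subst Even (trans (sym da≡H) da≡dk) evenH) odd)
      bySide _ (tri≈ _ k≡j _) = ⊥-elim (k≢j k≡j)
      bySide (inj₁ (_ , j≡last)) (tri> _ _ j<k) =
        ⊥-elim (ℕP.<⇒≱ (subst (ℕ._< toℕ k) (trans (cong toℕ j≡last) toℕ-last) j<k) (toℕ≤t k))
      bySide (inj₂ (inj₂ (_ , _ , _ , rightmost))) (tri> _ _ j<k) = ⊥-elim (rightmost k j<k (k-top j<k))
      bySide (inj₂ (inj₁ (_ , oddH , _ , _))) (tri> _ _ j<k) =
        (λ _ → j<k , j , j<k , j-highest k 1≤dk) ,
        (λ even → ⊥-elim (even∧odd (d k) even (subst Odd (sym (k-top j<k)) oddH)))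

    signedSide-right : ∀ k → k ≢ j → 1 ℕ.≤ d k → (∀ c → k Fin.< c → d c ℕ.≤ d k) → SignedSide k
    signedSide-right k k≢j 1≤dk lowerRight with findGreatest (λ c → d k ℕ.≤? d c)
    ... | inj₂ none = ⊥-elim (none k ℕP.≤-refl)
    ... | inj₁ (a , dk≤da , greatest) = bySide strongly (<-cmp k j)
      where
      k≤a : k Fin.≤ a
      k≤a = ℕP.≮⇒≥ (λ a<k → greatest k a<k ℕP.≤-refl)
      da≡dk : d a ≡ d k
      da≡dk with <-cmp a k
      ... | tri> _ _ k<a = ℕP.≤-antisym (lowerRight a k<a) dk≤da
      ... | tri≈ _ refl _ = refl
      ... | tri< a<k _ _ = ⊥-elim (ℕP.<⇒≱ a<k k≤a)
      a-odd-or-top : Odd (d a) ⊎ d a ≡ H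
      a-odd-or-top = proj₂ (boundary a) (toRightExtremal a
        (λ c a<c → subst (d c ℕ.<_) (sym da≡dk) (ℕP.≰⇒> (greatest c a<c))))
      k-top : k Fin.< j → d k ≡ H
      k-top k<j = ℕP.≤-antisym (height≤H k) (subst (ℕ._≤ d k) (j-top k 1≤dk) (lowerRight j k<j))
      bySide : StronglyExtremal d j → Tri (k Fin.< j) (k ≡ j) (j Fin.< k) → SignedSide k
      bySide se (tri> _ _ j<k) = (λ _ → j<k , j , j<k , j-highest k 1≤dk) , notEven se a-odd-or-top
        where
        notEven : StronglyExtremal d j → Odd (d a) ⊎ d a ≡ H → Even (d k) → _
        notEven _ (inj₁ odd) even = ⊥-elim (even∧odd (d k) even (subst Odd da≡dk odd))
        notEven (inj₁ (H≡0 , _)) (inj₂ _) _ = ⊥-elim (nonempty k 1≤dk H≡0)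
        notEven (inj₂ (inj₂ (_ , _ , _ , rightmost))) (inj₂ da≡H) _ = ⊥-elim (rightmost a (ℕP.<-≤-trans j<k k≤a) da≡H)
        notEven (inj₂ (inj₁ (_ , oddH , _ , _))) (inj₂ da≡H) even =
          ⊥-elim (even∧odd (d k) even (subst Odd (trans (sym da≡H) da≡dk) oddH))
      bySide _ (tri≈ _ k≡j _) = ⊥-elim (k≢j k≡j)
      bySide (inj₁ (H≡0 , _)) (tri< _ _ _) = ⊥-elim (nonempty k 1≤dk H≡0)
      bySide (inj₂ (inj₁ (_ , _ , _ , leftmost))) (tri< k<j _ _) = ⊥-elim (leftmost k k<j (k-top k<j))
      bySide (inj₂ (inj₂ (_ , evenH , _ , _))) (tri< k<j _ _) =
        (λ odd → ⊥-elim (even∧odd (d k) (subst Even (sym (k-top k<j)) evenH) odd)) ,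
        (λ _ → k<j , j , k<j , j-highest k 1≤dk)

    emptySide : ∀ k → k ≢ j → d k ≡ 0 → OneSideLower k → k Fin.< j × toℕ k ℕ.< t
    emptySide k k≢j dk≡0 side = bySide strongly
      where
      notLast : 1 ℕ.≤ H → toℕ k ℕ.< t
      notLast 1≤H = ℕP.≤∧≢⇒< (toℕ≤t k) (λ k≡t →
        ℕP.<⇒≱ (last-reaches-1 1≤H)
          (ℕP.≤-reflexive (trans (sym (cong d (toℕ-injective (trans k≡t (sym toℕ-last))))) dk≡0)))
      bySide : StronglyExtremal d j → k Fin.< j × toℕ k ℕ.< t
      bySide (inj₁ (_ , j≡last)) = subst (toℕ k ℕ.<_) (sym (trans (cong toℕ j≡last) toℕ-last)) k<t , k<t
        where
        k<t : toℕ k ℕ.< t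
        k<t = ℕP.≤∧≢⇒< (toℕ≤t k) (λ k≡t → k≢j (trans (toℕ-injective (trans k≡t (sym toℕ-last))) (sym j≡last)))
      bySide (inj₂ nonempty′) = leftOfJ side (<-cmp k j) , notLast 1≤H
        where
        H≢0 : H ≢ 0
        H≢0 = [ proj₁ , proj₁ ]′ nonempty′
        dj≡H : d j ≡ H
        dj≡H = [ (λ x → proj₁ (proj₂ (proj₂ x))) , (λ x → proj₁ (proj₂ (proj₂ x))) ]′ nonempty′
        1≤H : 1 ℕ.≤ H
        1≤H = ℕP.n≢0⇒n>0 H≢0
        k<last : k Fin.< last
        k<last = subst (toℕ k ℕ.<_) (sym toℕ-last) (notLast 1≤H)
        leftOfJ : OneSideLower k → Tri (k Fin.< j) (k ≡ j) (j Fin.< k) → k Fin.< j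
        leftOfJ (inj₂ lowerRight) _ = ⊥-elim (ℕP.<⇒≱ (last-reaches-1 1≤H) (subst (d last ℕ.≤_) dk≡0 (lowerRight last k<last)))
        leftOfJ (inj₁ _) (tri< k<j _ _) = k<j
        leftOfJ (inj₁ _) (tri≈ _ k≡j _) = ⊥-elim (k≢j k≡j)
        leftOfJ (inj₁ lowerLeft) (tri> _ _ j<k) = ⊥-elim (H≢0 (trans (sym dj≡H) (ℕP.n≤0⇒n≡0 (subst (d j ℕ.≤_) dk≡0 (lowerLeft j j<k)))))

    sgn-right : ∀ k → j Fin.< k → sgnDiff k j ≡ + 1
    sgn-right k j<k with j Fin.<? k
    ... | yes _ = refl
    ... | no j≮k = ⊥-elim (j≮k j<k)

    sgn-left : ∀ k → k Fin.< j → sgnDiff k j ≡ - + 1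
    sgn-left k k<j with j Fin.<? k
    ... | yes j<k = ⊥-elim (ℕP.<-asym k<j j<k)
    ... | no _ = refl

    SignedEntry : Col → Set
    SignedEntry k = Σ (Fin t) (λ i → ∀ i′ → fT d b k i′ ≡ sgnDiff k j * δ i i′)

    -- First half of the theorem: quasi-extremal columns have a signed single entry,
    -- namely −c_k for an empty column, and otherwise the entry of the neighbour at the
    -- top level (left neighbour if h_k is odd, right one if it is even).
    oneSided⇒signedEntry : ∀ k → k ≢ j → OneSideLower k → SignedEntry k
    oneSided⇒signedEntry k k≢j side with d k ℕ.≟ 0
    ... | yes dk≡0 = Fin.fromℕ< k<t , λ i′ → begin
        fT d b k i′                                      ≡⟨ fT-oneSided-empty k side dk≡0 i′ ⟩
        - δ (Fin.inject₁ i′) k                           ≡⟨ cong -_ (δ-toℕ (Fin.inject₁ i′) k i′ (Fin.fromℕ< k<t)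
                                                              (FinP.toℕ-inject₁ i′) (sym (FinP.toℕ-fromℕ< k<t))) ⟩
        - δ i′ (Fin.fromℕ< k<t)                          ≡⟨ cong -_ (δ-sym i′ (Fin.fromℕ< k<t)) ⟩
        - δ (Fin.fromℕ< k<t) i′                          ≡⟨ sym (ℤP.-1*i≡-i _) ⟩
        - + 1 * δ (Fin.fromℕ< k<t) i′                    ≡⟨ cong (_* δ (Fin.fromℕ< k<t) i′) (sym (sgn-left k k<j)) ⟩
        sgnDiff k j * δ (Fin.fromℕ< k<t) i′              ∎
      where
      k<j = proj₁ (emptySide k k≢j dk≡0 side)
      k<t = proj₂ (emptySide k k≢j dk≡0 side)
    ... | no dk≢0 = byParity (parity (d k))
      where
      1≤dk : 1 ℕ.≤ d k
      1≤dk = ℕP.n≢0⇒n>0 dk≢0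
      signedSide : SignedSide k
      signedSide = [ signedSide-left k k≢j 1≤dk , signedSide-right k k≢j 1≤dk ]′ side
      byParity : Even (d k) ⊎ Odd (d k) → SignedEntry k
      byParity (inj₂ odd) with proj₁ signedSide odd | leftNb (d k) k in leftNb≡
      ... | _ , c , c<k , dk≤dc | noLeft none = ⊥-elim (none c c<k dk≤dc)
      ... | j<k , _ | leftAt u _ _ _ = b u (d k) , λ i′ → begin
        fT d b k i′                                       ≡⟨ fT-oneSided-top k side 1≤dk i′ ⟩
        nbrTerm (d k) k i′                                ≡⟨ nbrTerm-odd (d k) k i′ odd ⟩
        atLeft (leftNb (d k) k) (λ u → entry i′ u (d k))  ≡⟨ cong (λ L → atLeft L (λ u → entry i′ u (d k))) leftNb≡ ⟩
        δ i′ (b u (d k))                                  ≡⟨ δ-sym i′ (b u (d k)) ⟩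
        δ (b u (d k)) i′                                  ≡⟨ sym (ℤP.*-identityˡ _) ⟩
        + 1 * δ (b u (d k)) i′                            ≡⟨ cong (_* δ (b u (d k)) i′) (sym (sgn-right k j<k)) ⟩
        sgnDiff k j * δ (b u (d k)) i′                    ∎
      byParity (inj₁ even) with proj₂ signedSide even | rightNb (d k) k in rightNb≡
      ... | _ , c , k<c , dk≤dc | noRight none = ⊥-elim (none c k<c dk≤dc)
      ... | k<j , _ | rightAt v _ _ _ = b v (d k) , λ i′ → begin
        fT d b k i′                                          ≡⟨ fT-oneSided-top k side 1≤dk i′ ⟩
        nbrTerm (d k) k i′                                   ≡⟨ nbrTerm-even (d k) k i′ even ⟩
        atRight (rightNb (d k) k) (λ v → - entry i′ v (d k)) ≡⟨ cong (λ R → atRight R (λ v → - entry i′ v (d k))) rightNb≡ ⟩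
        - δ i′ (b v (d k))                                   ≡⟨ cong -_ (δ-sym i′ (b v (d k))) ⟩
        - δ (b v (d k)) i′                                   ≡⟨ sym (ℤP.-1*i≡-i _) ⟩
        - + 1 * δ (b v (d k)) i′                             ≡⟨ cong (_* δ (b v (d k)) i′) (sym (sgn-left k k<j)) ⟩
        sgnDiff k j * δ (b v (d k)) i′                       ∎

  -- At level h_k + 1 it lies strictly between its neighbours u₁ < k < v₁, which gives
  -- 2 c_β (h_k even, β = b(u₁, h_k + 1)) resp. −2 c_β (h_k odd, β = b(v₁, h_k + 1)).
  -- All other levels avoid c_β, so the coefficient of m^k is not ±c_i.
  module BetweenHigherColumns (k cL cR : Col) (cL<k : cL Fin.< k) (dk<dcL : d k ℕ.< d cL)
                              (k<cR : k Fin.< cR) (dk<dcR : d k ℕ.< d cR) where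
    h : ℕ
    h = d k

    u₁-found = getLeftNb (suc h) k cL cL<k dk<dcL
    v₁-found = getRightNb (suc h) k cR k<cR dk<dcR
    u₁ = proj₁ u₁-found
    v₁ = proj₁ v₁-found
    isU₁ : IsLeftNb (suc h) k u₁
    isU₁ = proj₂ u₁-found
    isV₁ : IsRightNb (suc h) k v₁
    isV₁ = proj₂ v₁-found

    -- Levels ≥ h_k + 2 only involve entries left of u₁ or at/right of v₁.
    vanishing-above : ∀ β → toℕ u₁ ℕ.≤ toℕ β → toℕ β ℕ.< toℕ v₁ →
      ∀ s → suc (suc h) ℕ.≤ s → levelCoeff s k β ≡ + 0
    vanishing-above β u₁≤β β<v₁ (suc s) h+2≤s+1 with parity s
    ... | inj₁ even = trans (levelCoeff-above-odd (suc s) k β (cong not even) (ℕP.<-trans (ℕP.n<1+n h) h+2≤s+1))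
                            (avoid (leftNb (suc s) k) (rightNb (suc s) k))
      where
      avoid : ∀ L R → across L R (λ u v → + 2 * entry β u (suc s)) ≡ + 0
      avoid (noLeft _) R = refl
      avoid (leftAt _ _ _ _) (noRight _) = refl
      avoid (leftAt u u<k su gapU) (rightAt v k<v sv gapV) with entry-above-left k s even (ℕP.≤-pred h+2≤s+1) u v (u<k , su , gapU) (k<v , sv , gapV)
      ... | u₀ , isU₀ , entry<u₀ = cong (+ 2 *_) (δ-≢ β (b u (suc s)) (λ e → ℕP.<⇒≱ entry<u₀ (ℕP.≤-trans u₀≤u₁ (subst (toℕ u₁ ℕ.≤_) e u₁≤β))))
        where
        u₀≤u₁ : toℕ u₀ ℕ.≤ toℕ u₁
        u₀≤u₁ = leftNb-greatest isU₁ (proj₁ isU₀) (ℕP.≤-trans (ℕP.≤-pred h+2≤s+1) (proj₁ (proj₂ isU₀)))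
    ... | inj₂ odd = trans (levelCoeff-above-even (suc s) k β (cong not odd) (ℕP.<-trans (ℕP.n<1+n h) h+2≤s+1))
                           (avoid (leftNb (suc s) k) (rightNb (suc s) k))
      where
      avoid : ∀ L R → across L R (λ u v → + 2 * - entry β v (suc s)) ≡ + 0
      avoid (noLeft _) R = refl
      avoid (leftAt _ _ _ _) (noRight _) = refl
      avoid (leftAt u u<k su gapU) (rightAt v k<v sv gapV) with entry-above-right k s odd (ℕP.≤-pred h+2≤s+1) u v (u<k , su , gapU) (k<v , sv , gapV)
      ... | v₀ , isV₀ , v₀≤entry = cong (λ z → + 2 * - z) (δ-≢ β (b v (suc s)) (λ e → ℕP.<⇒≱ β<v₁ (ℕP.≤-trans v₁≤v₀ (subst (toℕ v₀ ℕ.≤_) (sym e) v₀≤entry))))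
        where
        v₁≤v₀ : toℕ v₁ ℕ.≤ toℕ v₀
        v₁≤v₀ = rightNb-least isV₁ (proj₁ isV₀) (ℕP.≤-trans (ℕP.≤-pred h+2≤s+1) (proj₁ (proj₂ isV₀)))

    h<H : h ℕ.< H
    h<H = ℕP.<-≤-trans dk<dcL (height≤H cL)

    fT-from-parts : ∀ β val →
      - δ (Fin.inject₁ β) k + sumBelow h (λ s → levelCoeff (suc s) k β) ≡ + 0 →
      levelCoeff (suc h) k β ≡ val → (∀ s → suc (suc h) ℕ.≤ s → levelCoeff s k β ≡ + 0) →
      fT d b k β ≡ val
    fT-from-parts β val lower top above = begin
        fT d b k β
      ≡⟨ fT-split k β ⟩
        - δ (Fin.inject₁ β) k + (sumBelow h levels + sumBelow (H ℕ.∸ h) higher)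
      ≡⟨ cong (λ z → - δ (Fin.inject₁ β) k + (sumBelow h levels + z)) upper ⟩
        - δ (Fin.inject₁ β) k + (sumBelow h levels + val)
      ≡⟨ sym (ℤP.+-assoc (- δ (Fin.inject₁ β) k) _ val) ⟩
        (- δ (Fin.inject₁ β) k + sumBelow h levels) + val
      ≡⟨ cong (_+ val) lower ⟩
        + 0 + val
      ≡⟨ ℤP.+-identityˡ val ⟩
        val
      ∎
      where
      levels higher : ℕ → ℤ
      levels s = levelCoeff (suc s) k β
      higher x = levelCoeff (suc (h ℕ.+ x)) k β
      upper : sumBelow (H ℕ.∸ h) higher ≡ val
      upper = begin
          sumBelow (H ℕ.∸ h) higher
        ≡⟨ cong (λ m → sumBelow m higher) (ℕP.+-∸-assoc 1 h<H) ⟩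
          sumBelow (suc (H ℕ.∸ suc h)) higher
        ≡⟨ sumBelow-front (H ℕ.∸ suc h) higher ⟩
          higher 0 + sumBelow (H ℕ.∸ suc h) (higher ∘ suc)
        ≡⟨ cong₂ _+_ (trans (cong (λ m → levelCoeff (suc m) k β) (ℕP.+-identityʳ h)) top)
                     (sumBelow-zero (H ℕ.∸ suc h) (higher ∘ suc) (λ x → above _ (s≤s (ℕP.≤-trans (s≤s (ℕP.m≤m+n h x)) (ℕP.≤-reflexive (sym (ℕP.+-suc h x))))))) ⟩
          val + + 0
        ≡⟨ ℤP.+-identityʳ val ⟩
          val
        ∎

    lower-vanishing : ∀ β → (h ≡ 0 → toℕ β ≢ toℕ k) → (1 ℕ.≤ h → nbrTerm h k β ≡ + 0) →
      - δ (Fin.inject₁ β) k + sumBelow h (λ s → levelCoeff (suc s) k β) ≡ + 0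
    lower-vanishing β β≢k nbr≡0 with h ℕ.≟ 0
    ... | yes h≡0 = begin
        - δ (Fin.inject₁ β) k + sumBelow h (λ s → levelCoeff (suc s) k β)  ≡⟨ cong (λ m → - δ (Fin.inject₁ β) k + sumBelow m (λ s → levelCoeff (suc s) k β)) h≡0 ⟩
        - δ (Fin.inject₁ β) k + + 0                                         ≡⟨ cong (λ z → - z + + 0) (δ-≢ (Fin.inject₁ β) k (λ e → β≢k h≡0 (trans (sym (FinP.toℕ-inject₁ β)) e))) ⟩
        + 0                                                                 ∎
    ... | no h≢0 = begin
        - δ (Fin.inject₁ β) k + sumBelow h (λ s → levelCoeff (suc s) k β)  ≡⟨ cong (λ z → - δ (Fin.inject₁ β) k + z) (telescope k β h 1≤h ℕP.≤-refl) ⟩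
        - δ (Fin.inject₁ β) k + (ownTerm 1 k β + nbrTerm h k β)             ≡⟨ sym (ℤP.+-assoc (- δ (Fin.inject₁ β) k) _ _) ⟩
        (- δ (Fin.inject₁ β) k + ownTerm 1 k β) + nbrTerm h k β             ≡⟨ cong₂ _+_ (h-cancels-own k β 1≤h) (nbr≡0 1≤h) ⟩
        + 0                                                                 ∎
      where
      1≤h : 1 ℕ.≤ h
      1≤h = ℕP.n≢0⇒n>0 h≢0

    u₁<v₁ : u₁ Fin.< v₁
    u₁<v₁ = ℕP.<-trans (proj₁ isU₁) (proj₁ isV₁)

    -- h_k even: β = b(u₁, h_k + 1) satisfies u₁ ≤ β < k and the coefficient is 2.
    even-height : Even h → Σ (Fin t) (λ β → fT d b k β ≡ + 2)
    even-height even = β , fT-from-parts β (+ 2) (lower-vanishing β (λ _ e → ℕP.<⇒≢ β<k e) nbr≡0) top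
                             (vanishing-above β u₁≤β (ℕP.<-trans β<k (proj₁ isV₁)))
      where
      β : Fin t
      β = b u₁ (suc h)
      odd′ : Odd (suc h)
      odd′ = cong not even
      nonExtremal : NonExtremal d u₁ (suc h)
      nonExtremal = s≤s z≤n , proj₁ (proj₂ isU₁) , (λ _ → v₁ , u₁<v₁ , proj₁ (proj₂ isV₁)) ,
                    (λ e → ⊥-elim (even∧odd (suc h) e odd′))
      u₁≤β : toℕ u₁ ℕ.≤ toℕ β
      u₁≤β = proj₁ (proj₁ (entryBounds (suc h) (s≤s z≤n) u₁ nonExtremal) odd′)
      -- β is copied from the right neighbour r ≤ k of u₁ at level h, and lies left of r.
      β<k : toℕ β ℕ.< toℕ k
      β<k with h ℕ.≟ 0
      ... | yes h≡0 = subst (ℕ._< toℕ k) (sym level1) (proj₁ isU₁)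
        where
        level1 : toℕ (b u₁ (suc h)) ≡ toℕ u₁
        level1 = trans (cong (λ m → toℕ (b u₁ (suc m))) h≡0)
                       (entry-level1 u₁ (subst (λ m → NonExtremal d u₁ (suc m)) h≡0 nonExtremal))
      ... | no h≢0 = subst (λ z → toℕ z ℕ.< toℕ k) (sym copied) (ℕP.<-≤-trans entry<r (rightNb-least isR (proj₁ isU₁) ℕP.≤-refl))
        where
        1≤h = ℕP.n≢0⇒n>0 h≢0
        h≤du₁ = ℕP.≤-trans (ℕP.n≤1+n h) (proj₁ (proj₂ isU₁))
        r-found = getRightNb h u₁ k (proj₁ isU₁) ℕP.≤-refl
        r = proj₁ r-found
        isR = proj₂ r-found
        copied : b u₁ (suc h) ≡ b r h
        copied = entry-even u₁ h r 1≤h nonExtremal even (isRightNb⇒RightNb isR h≤du₁)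
        entry<r : toℕ (b r h) ℕ.< toℕ r
        entry<r = proj₁ (proj₂ (entryBounds h 1≤h r (1≤h , proj₁ (proj₂ isR) ,
                    (λ o → ⊥-elim (even∧odd h even o)) , (λ _ → u₁ , proj₁ isR , h≤du₁))) even)
      -- The right neighbour v of k at level h has its entry at or right of k.
      nbr≡0 : 1 ℕ.≤ h → nbrTerm h k β ≡ + 0
      nbr≡0 1≤h = trans (nbrTerm-even h k β even) (avoid (rightNb h k))
        where
        avoid : (R : NearestRight (Reaches h) k) → atRight R (λ v → - entry β v h) ≡ + 0
        avoid (noRight _) = refl
        avoid (rightAt v k<v hv gap) = cong -_ (δ-≢ β (b v h) (λ e → ℕP.<⇒≱ β<k (subst (toℕ k ℕ.≤_) (sym e) k≤entry)))
          where
          k≤entry : toℕ k ℕ.≤ toℕ (b v h)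
          k≤entry = proj₂ (proj₂ (entryBounds h 1≤h v (1≤h , hv , (λ o → ⊥-elim (even∧odd h even o)) ,
                      (λ _ → k , k<v , ℕP.≤-refl))) even) k (k<v , ℕP.≤-refl , gap)
      top : levelCoeff (suc h) k β ≡ + 2
      top = trans (levelCoeff-above-odd (suc h) k β odd′ (ℕP.n<1+n h)) (between (leftNb (suc h) k) (rightNb (suc h) k))
        where
        between : ∀ L R → across L R (λ u v → + 2 * entry β u (suc h)) ≡ + 2
        between (noLeft none) R = ⊥-elim (none cL cL<k dk<dcL)
        between (leftAt _ _ _ _) (noRight none) = ⊥-elim (none cR k<cR dk<dcR)
        between (leftAt u u<k su gap) (rightAt _ _ _ _) with leftNb-unique (u<k , su , gap) isU₁
        ... | refl = cong (+ 2 *_) (δ-refl β)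

    -- h_k odd: β = b(v₁, h_k + 1) satisfies k ≤ β < v₁ and the coefficient is −2.
    odd-height : Odd h → Σ (Fin t) (λ β → fT d b k β ≡ - + 2)
    odd-height odd = β , fT-from-parts β (- + 2) (lower-vanishing β (λ h≡0 → ⊥-elim (ℕP.<⇒≢ 1≤h (sym h≡0))) nbr≡0) top
                           (vanishing-above β (ℕP.≤-trans (ℕP.<⇒≤ (proj₁ isU₁)) k≤β) β<v₁)
      where
      β : Fin t
      β = b v₁ (suc h)
      1≤h : 1 ℕ.≤ h
      1≤h = odd⇒positive odd
      even′ : Even (suc h)
      even′ = cong not odd
      nonExtremal : NonExtremal d v₁ (suc h)
      nonExtremal = s≤s z≤n , proj₁ (proj₂ isV₁) , (λ o → ⊥-elim (even∧odd (suc h) even′ o)) ,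
                    (λ _ → u₁ , u₁<v₁ , proj₁ (proj₂ isU₁))
      β<v₁ : toℕ β ℕ.< toℕ v₁
      β<v₁ = proj₁ (proj₂ (entryBounds (suc h) (s≤s z≤n) v₁ nonExtremal) even′)
      -- β is copied from the left neighbour l ≥ k of v₁ at level h, and lies at or right of l.
      h≤dv₁ = ℕP.≤-trans (ℕP.n≤1+n h) (proj₁ (proj₂ isV₁))
      l-found = getLeftNb h v₁ k (proj₁ isV₁) ℕP.≤-refl
      l = proj₁ l-found
      isL = proj₂ l-found
      copied : b v₁ (suc h) ≡ b l h
      copied = entry-odd v₁ h l 1≤h nonExtremal odd (isLeftNb⇒LeftNb isL h≤dv₁)
      l≤entry : toℕ l ℕ.≤ toℕ (b l h)
      l≤entry = proj₁ (proj₁ (entryBounds h 1≤h l (1≤h , proj₁ (proj₂ isL) ,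
                  (λ _ → v₁ , proj₁ isL , h≤dv₁) , (λ e → ⊥-elim (even∧odd h e odd)))) odd)
      k≤β : toℕ k ℕ.≤ toℕ β
      k≤β = subst (λ z → toℕ k ℕ.≤ toℕ z) (sym copied) (ℕP.≤-trans (leftNb-greatest isL (proj₁ isV₁) ℕP.≤-refl) l≤entry)
      -- The left neighbour u of k at level h has its entry strictly left of k.
      nbr≡0 : 1 ℕ.≤ h → nbrTerm h k β ≡ + 0
      nbr≡0 _ = trans (nbrTerm-odd h k β odd) (avoid (leftNb h k))
        where
        avoid : (L : NearestLeft (Reaches h) k) → atLeft L (λ u → entry β u h) ≡ + 0
        avoid (noLeft _) = refl
        avoid (leftAt u u<k hu gap) = δ-≢ β (b u h) (λ e → ℕP.<⇒≱ entry<k (subst (toℕ k ℕ.≤_) e k≤β))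
          where
          entry<k : toℕ (b u h) ℕ.< toℕ k
          entry<k = proj₂ (proj₁ (entryBounds h 1≤h u (1≤h , hu , (λ _ → k , u<k , ℕP.≤-refl) ,
                      (λ e → ⊥-elim (even∧odd h e odd)))) odd) k (u<k , ℕP.≤-refl , gap)
      top : levelCoeff (suc h) k β ≡ - + 2
      top = trans (levelCoeff-above-even (suc h) k β even′ (ℕP.n<1+n h)) (between (leftNb (suc h) k) (rightNb (suc h) k))
        where
        between : ∀ L R → across L R (λ u v → + 2 * - entry β v (suc h)) ≡ - + 2
        between (noLeft none) R = ⊥-elim (none cL cL<k dk<dcL)
        between (leftAt _ _ _ _) (noRight none) = ⊥-elim (none cR k<cR dk<dcR)
        between (leftAt _ _ _ _) (rightAt v k<v sv gap) with rightNb-unique (k<v , sv , gap) isV₁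
        ... | refl = cong (λ z → + 2 * - z) (δ-refl β)

    not-signed : ∀ σ → ∣ σ ∣ ≡ 1 → ∀ i → ¬ (∀ i′ → fT d b k i′ ≡ σ * δ i i′)
    not-signed σ ∣σ∣≡1 i signed with doubled (parity h)
      where
      doubled : Even h ⊎ Odd h → Σ (Fin t) (λ β → ∣ fT d b k β ∣ ≡ 2)
      doubled (inj₁ even) with even-height even
      ... | β , fT≡2 = β , cong ∣_∣ fT≡2
      doubled (inj₂ odd) with odd-height odd
      ... | β , fT≡-2 = β , cong ∣_∣ fT≡-2
    ... | β , ∣fT∣≡2 = ℕP.<⇒≱ (ℕP.n<1+n 1) (subst (ℕ._≤ 1) (trans (cong ∣_∣ (sym (signed β))) ∣fT∣≡2) (∣unit*δ∣≤1 σ ∣σ∣≡1 i β))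

lemma5p5 : (t : ℕ) (d : Diagram t) (b : Fin (suc t) → ℕ → Fin t) →
    Boundary d → Complete d → IsTableau d b →
    (j : Fin (suc t)) → StronglyExtremal d j →
    (k : Fin (suc t)) → k ≢ j →
    (Σ (Fin t) (λ i → ∀ i′ → fT d b k i′ ≡ sgnDiff k j * δ i i′))
      ⇔ QuasiExtremal d j k
lemma5p5 t d b boundary complete tableau j strongly k k≢j = mk⇔ signed⇒quasiExtremal quasiExtremal⇒signed
  where
  open CompleteTableau d b boundary complete tableau
  open StronglyExtremalColumn j strongly

  quasiExtremal⇒signed : QuasiExtremal d j k → SignedEntry k
  quasiExtremal⇒signed (inj₁ (_ , lowerLeft)) = oneSided⇒signedEntry k k≢j (inj₁ lowerLeft)
  quasiExtremal⇒signed (inj₂ (_ , lowerRight)) = oneSided⇒signedEntry k k≢j (inj₂ lowerRight)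

  -- A column that is not quasi-extremal has strictly higher columns on both sides.
  signed⇒quasiExtremal : SignedEntry k → QuasiExtremal d j k
  signed⇒quasiExtremal (i , signed)
    with findLeast (λ c → (c Fin.<? k) ×-dec (d k ℕ.<? d c)) | findLeast (λ c → (k Fin.<? c) ×-dec (d k ℕ.<? d c))
  ... | inj₂ noneLeft | _ = inj₁ (k≢j , λ c c<k → ℕP.≮⇒≥ (λ dk<dc → noneLeft c (c<k , dk<dc)))
  ... | inj₁ _ | inj₂ noneRight = inj₂ (k≢j , λ c k<c → ℕP.≮⇒≥ (λ dk<dc → noneRight c (k<c , dk<dc)))
  ... | inj₁ (cL , (cL<k , dk<dcL) , _) | inj₁ (cR , (k<cR , dk<dcR) , _) =
    ⊥-elim (BetweenHigherColumns.not-signed k cL cR cL<k dk<dcL k<cR dk<dcR (sgnDiff k j) (∣sgnDiff∣≡1 k j) i signed)
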